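{- Let $G$ be a Helly graph and $k$ a non-negative integer. Then $G$ has $H_2^{k}$ as an isometric subgraph if and only if there exist four vertices in $G$ that induce a $C_4$ in $G^\ell$ for every integer $\ell\in[k+1,2k]$ and induce a diamond in $G^{2k+1}$.
   Context: Graphs are finite, connected, unweighted, undirected and simple; $d$ is the shortest-path distance. A subgraph is isometric if it is induced and distance-preserving; "has $H$ as an isometric subgraph" means has an isometric subgraph isomorphic to $H$. A graph is Helly if every family of pairwise intersecting disks $D(v,r)=\{u:d(u,v)\le r\}$ has a common vertex. $G^\ell$ is the graph on $V(G)$ with $uv$ an edge iff $0<d(u,v)\le \ell$; $C_4$ is the cycle on four vertices; a diamond is a cycle on four vertices with exactly one chord. King-grid: the graph on $\mathbb{Z}^2$ in which distinct $(x,y),(x',y')$ are adjacent iff $\max(|x-x'|,|y-y'|)=1$; for $u=(x,y)$ let $s(u)=x+y$, $t(u)=x-y$. $H_2^{m}$ is the subgraph of the King-grid induced by $\{u: 0\le s(u)\le 2m+1,\ -1\le t(u)\le 2m\}\cup\{(-1,0),(2m+1,1)\}$. -}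

module Defs where

open import Data.Nat as ℕ using (ℕ; zero; suc; _≤_; _+_; _*_; _⊔_)
open import Data.Integer as ℤ using (ℤ; +_; -[1+_]; ∣_∣)
open import Data.Fin using (Fin; toℕ)
open import Data.Fin.Permutation using (Permutation′; _⟨$⟩ʳ_)
open import Data.Bool using (Bool; true; false; T)
open import Data.Product using (Σ; ∃; ∃-syntax; _×_; _,_; proj₁)
open import Data.Sum using (_⊎_)
open import Data.List using (List)
open import Data.List.Membership.Propositional using (_∈_)
open import Relation.Binary.PropositionalEquality using (_≡_; _≢_)
open import Relation.Nullary using (¬_)
open import Function.Bundles using (_⇔_)

record Graph : Set₁ where
  field
    V   : Set
    Adj : V → V → Set
open Graph public

Finite : Graph → Set
Finite G = Σ (List (V G)) λ xs → ∀ v → v ∈ xs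

Symmetric : Graph → Set
Symmetric G = ∀ {u v} → Adj G u v → Adj G v u

Irreflexive : Graph → Set
Irreflexive G = ∀ {u} → ¬ Adj G u u

SimpleGraph : Graph → Set
SimpleGraph G = Symmetric G × Irreflexive G

data Walk (G : Graph) : V G → V G → ℕ → Set where
  here : ∀ {u} → Walk G u u 0
  step : ∀ {u v w n} → Adj G u v → Walk G v w n → Walk G u w (suc n)

Connected : Graph → Set
Connected G = ∀ u v → ∃[ n ] Walk G u v n

Dist : (G : Graph) → V G → V G → ℕ → Set
Dist G u v m = Walk G u v m × (∀ n → Walk G u v n → m ≤ n)

InDisk : (G : Graph) → V G → ℕ → V G → Set
InDisk G v r u = ∃[ m ] (Dist G u v m × m ≤ r)

Helly : Graph → Set
Helly G = (F : List (V G × ℕ)) →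
  (∀ {p q} → p ∈ F → q ∈ F → ∃[ u ] (InDisk G (proj₁ p) (Data.Product.proj₂ p) u
                                     × InDisk G (proj₁ q) (Data.Product.proj₂ q) u)) →
  ∃[ u ] (∀ {p} → p ∈ F → InDisk G (proj₁ p) (Data.Product.proj₂ p) u)

Pow : Graph → ℕ → Graph
Pow G ℓ = record { V = V G ; Adj = λ u v → u ≢ v × ∃[ m ] (Dist G u v m × m ≤ ℓ) }

IsometricSubgraph : (H G : Graph) → Set
IsometricSubgraph H G = Σ (V H → V G) λ f →
    (∀ a b → f a ≡ f b → a ≡ b)
  × (∀ a b → Adj H a b ⇔ Adj G (f a) (f b))
  × (∀ a b m → Dist H a b m ⇔ Dist G (f a) (f b) m)

c4ℕ : ℕ → ℕ → Bool
c4ℕ 0 1 = true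
c4ℕ 1 0 = true
c4ℕ 1 2 = true
c4ℕ 2 1 = true
c4ℕ 2 3 = true
c4ℕ 3 2 = true
c4ℕ 3 0 = true
c4ℕ 0 3 = true
c4ℕ _ _ = false

diamondℕ : ℕ → ℕ → Bool
diamondℕ 0 2 = true
diamondℕ 2 0 = true
diamondℕ i j = c4ℕ i j

C4 : Fin 4 → Fin 4 → Set
C4 i j = T (c4ℕ (toℕ i) (toℕ j))

Diamond : Fin 4 → Fin 4 → Set
Diamond i j = T (diamondℕ (toℕ i) (toℕ j))

Induces : (G : Graph) → (Fin 4 → Fin 4 → Set) → (Fin 4 → V G) → Set
Induces G P w = Σ (Permutation′ 4) λ π → ∀ (i j : Fin 4) →
  Adj G (w (π ⟨$⟩ʳ i)) (w (π ⟨$⟩ʳ j)) ⇔ P i j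

s t : ℤ × ℤ → ℤ
s (x , y) = x ℤ.+ y
t (x , y) = x ℤ.- y

InH : ℕ → ℤ × ℤ → Set
InH m u = ((+ 0 ℤ.≤ s u) × (s u ℤ.≤ + (2 * m + 1)) × (-[1+ 0 ] ℤ.≤ t u) × (t u ℤ.≤ + (2 * m)))
        ⊎ (u ≡ (-[1+ 0 ] , + 0))
        ⊎ (u ≡ (+ (2 * m + 1) , + 1))

King : ℤ × ℤ → ℤ × ℤ → Set
King (x , y) (x' , y') = (∣ x ℤ.- x' ∣ ⊔ ∣ y ℤ.- y' ∣) ≡ 1

H2 : ℕ → Graph
H2 m = record { V = Σ (ℤ × ℤ) (InH m) ; Adj = λ a b → King (proj₁ a) (proj₁ b) }

-- Translating H₂ᵏ by (1 , k) puts it in ℕ², where its graph distance is the Chebyshev distance: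
-- greedy king steps stay inside the rectangle part, and the pendant corners A and C attach to it
-- geodesically. Consecutive corners B, A, D, C of the model are at distance k + 1, the diagonal
-- B–D has length 2k + 1 and A–C has length 2k + 2, so in an isometric copy they induce a C₄
-- in Gˡ for k + 1 ≤ ℓ ≤ 2k and a diamond in G^(2k+1). Conversely, these patterns force four vertices
-- into the same metric configuration: the non-edge of the diamond has distance at least 2k + 2, yet
-- is joined through each of the other two vertices by two sides of length at most k + 1.
-- The copy of the model is then grown one rectangle point p at a time. The disks around the images
-- of the points already placed, with radii their distances to p, pairwise intersect, so the Helly
-- property gives a common vertex. Since p lies on geodesics A–C and B–D, that vertex is at exact
-- distance from the corners, and since every other placed point is aligned with p and A or B, it is
-- at exact distance from all of them.

module Submission where

open import Defs
open import Data.Nat using (ℕ; zero; suc; pred; _+_; _*_; _∸_; _⊔_; _≤_; _<_; z≤n; s≤s; ∣_-_∣; _≟_; _≤?_)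
open import Data.Nat.Properties
open import Data.Nat.Induction using (<-wellFounded)
open import Data.Nat.Tactic.RingSolver using (solve)
open import Data.Integer as ℤ using (ℤ; +_; -[1+_]; _⊖_)
import Data.Integer.Properties as ℤ
open import Data.Integer.Tactic.RingSolver using (solve-∀)
open import Data.Bool using (true; false; T; T?)
open import Data.Unit using (tt)
open import Data.Fin using (Fin; zero; suc; toℕ) renaming (_≟_ to _≟ᶠ_)
open import Data.Fin.Properties using (all?)
open import Data.Fin.Permutation using (Permutation′; _⟨$⟩ʳ_; _⟨$⟩ˡ_; inverseʳ; inverseˡ; id)
open import Data.List using (List; []; _∷_; map; upTo; cartesianProduct; allFin)
open import Data.List.Relation.Unary.Any using (here; there)
open import Data.List.Membership.Propositional using (_∈_)
open import Data.List.Membership.Propositional.Properties using (∈-map⁺; ∈-map⁻; ∈-upTo⁺; ∈-cartesianProduct⁺; ∈-allFin)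
open import Data.Product using (Σ; ∃; _×_; _,_; proj₁; proj₂)
open import Data.Product.Properties using (≡-dec)
open import Data.Product.Function.NonDependent.Propositional using (_×-⇔_)
open import Data.Sum using (_⊎_; inj₁; inj₂) renaming (map to map-⊎)
open import Data.Empty using (⊥; ⊥-elim)
open import Induction.WellFounded using (Acc; acc)
open import Relation.Nullary using (¬_; Dec; yes; no)
open import Relation.Nullary.Decidable using (from-yes; ¬?; _×-dec_; _→-dec_)
open import Relation.Binary using (tri<; tri≈; tri>)
open import Relation.Binary.PropositionalEquality using (_≡_; _≢_; refl; sym; trans; cong; cong₂; subst; subst₂; module ≡-Reasoning)
open import Axiom.UniquenessOfIdentityProofs using (module Decidable⇒UIP)
open import Function.Bundles using (_⇔_; mk⇔; Equivalence)
open import Function.Properties.Equivalence using () renaming (trans to ⇔-trans)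

-- Linear arithmetic by certificate: add up the hypotheses into A ≤ B, and let the ring solver
-- check the identity L + B ≡ R + A.
≤-by-certificate : ∀ {L R A B} → A ≤ B → L + B ≡ R + A → L ≤ R
≤-by-certificate {L} {R} {A} {B} A≤B eq = +-cancelʳ-≤ A L R (≤-trans (+-monoʳ-≤ L A≤B) (≤-reflexive eq))

infixl 6 _⊕_
_⊕_ : ∀ {a b c d} → a ≤ b → c ≤ d → a + c ≤ b + d
_⊕_ = +-mono-≤

≤⇒∣-∣≤ : ∀ m n o → m ≤ n + o → n ≤ m + o → ∣ m - n ∣ ≤ o
≤⇒∣-∣≤ m n o m≤n+o n≤m+o with ≤-total m n
... | inj₁ m≤n = subst (_≤ o) (sym (m≤n⇒∣m-n∣≡n∸m m≤n)) (m≤n+o⇒m∸n≤o n m n≤m+o)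
... | inj₂ n≤m = subst (_≤ o) (sym (m≤n⇒∣n-m∣≡n∸m n≤m)) (m≤n+o⇒m∸n≤o m n m≤n+o)

+≡⇒∣-∣≡ : ∀ {m n o} → m + o ≡ n → ∣ n - m ∣ ≡ o
+≡⇒∣-∣≡ {m} {o = o} refl = trans (∣-∣-comm (m + o) m) (∣m-m+n∣≡n m o)

∣n-1+n∣≡1 : ∀ n → ∣ n - suc n ∣ ≡ 1
∣n-1+n∣≡1 zero = refl
∣n-1+n∣≡1 (suc n) = ∣n-1+n∣≡1 n

∣1+n-n∣≡1 : ∀ n → ∣ suc n - n ∣ ≡ 1
∣1+n-n∣≡1 n = trans (∣-∣-comm (suc n) n) (∣n-1+n∣≡1 n)

+-tight : ∀ {a b A B} → a ≤ A → b ≤ B → A + B ≤ a + b → a ≡ A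
+-tight {a} {b} {A} {B} a≤A b≤B sum≤ = ≤-antisym a≤A (+-cancelʳ-≤ B A a (≤-trans sum≤ (+-monoʳ-≤ a b≤B)))

∣-∣-additive : ∀ a b → b ≡ a + ∣ a - b ∣ ⊎ a ≡ b + ∣ a - b ∣
∣-∣-additive a b with ≤-total a b
... | inj₁ a≤b = inj₁ (trans (sym (m+[n∸m]≡n a≤b)) (cong (_+_ a) (sym (m≤n⇒∣m-n∣≡n∸m a≤b))))
... | inj₂ b≤a = inj₂ (trans (sym (m+[n∸m]≡n b≤a)) (cong (_+_ b) (sym (m≤n⇒∣n-m∣≡n∸m b≤a))))

⊔≡1 : ∀ {a b} → a ≤ 1 → b ≤ 1 → a ≡ 1 ⊎ b ≡ 1 → a ⊔ b ≡ 1
⊔≡1 _ b≤1 (inj₁ refl) = m≥n⇒m⊔n≡m b≤1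
⊔≡1 a≤1 _ (inj₂ refl) = m≤n⇒m⊔n≡n a≤1

module Walks (G : Graph) where

  _++ʷ_ : ∀ {u v w m n} → Walk G u v m → Walk G v w n → Walk G u w (m + n)
  here ++ʷ q = q
  step a p ++ʷ q = step a (p ++ʷ q)

  reverseʷ : Symmetric G → ∀ {u v n} → Walk G u v n → Walk G v u n
  reverseʷ symG here = here
  reverseʷ symG (step {n = n} a p) =
    subst (Walk G _ _) (+-comm n 1) (reverseʷ symG p ++ʷ step (symG a) here)

  splitAtʷ : ∀ {u w} m n → Walk G u w (m + n) → Σ (V G) λ v → Walk G u v m × Walk G v w n
  splitAtʷ zero n p = _ , here , p
  splitAtʷ (suc m) n (step a p) with splitAtʷ m n p
  ... | v , p₁ , p₂ = v , step a p₁ , p₂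

  walk0⇒≡ : ∀ {u v} → Walk G u v 0 → u ≡ v
  walk0⇒≡ here = refl

  walk1⇒Adj : ∀ {u v} → Walk G u v 1 → Adj G u v
  walk1⇒Adj (step a here) = a

  Dist-unique : ∀ {u v m n} → Dist G u v m → Dist G u v n → m ≡ n
  Dist-unique (p , p-min) (q , q-min) = ≤-antisym (p-min _ q) (q-min _ p)

  Dist-refl : ∀ {u} → Dist G u u 0
  Dist-refl = here , λ _ _ → z≤n

  Dist-sym : Symmetric G → ∀ {u v m} → Dist G u v m → Dist G v u m
  Dist-sym symG (p , p-min) = reverseʷ symG p , λ n q → p-min n (reverseʷ symG q)

  Dist0⇒≡ : ∀ {u v} → Dist G u v 0 → u ≡ v
  Dist0⇒≡ (p , _) = walk0⇒≡ p

  Dist-triangle : ∀ {u v w a b c} → Dist G u v a → Dist G v w b → Dist G u w c → c ≤ a + b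
  Dist-triangle (p , _) (q , _) (_ , r-min) = r-min _ (p ++ʷ q)

  Adj⇒Dist1 : Irreflexive G → ∀ {u v} → Adj G u v → Dist G u v 1
  Adj⇒Dist1 irr {u} a = step a here , λ
    { zero p → ⊥-elim (irr (subst (Adj G u) (sym (walk0⇒≡ p)) a))
    ; (suc n) p → s≤s z≤n }

  Dist-split : ∀ {u w} m n → Dist G u w (m + n) → Σ (V G) λ v → Dist G u v m × Dist G v w n
  Dist-split m n (p , p-min) with splitAtʷ m n p
  ... | v , p₁ , p₂ = v , (p₁ , λ k q → +-cancelʳ-≤ n m k (p-min _ (q ++ʷ p₂)))
                        , (p₂ , λ k q → +-cancelˡ-≤ m n k (p-min _ (p₁ ++ʷ q)))

  disks-meet : Symmetric G → ∀ {u w d r s} → Dist G u w d → d ≤ r + s →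
    Σ (V G) λ v → InDisk G u r v × InDisk G w s v
  disks-meet symG {u} {w} {d} {r} {s} D d≤r+s with r ≤? d
  ... | no r≰d = w , (d , Dist-sym symG D , ≰⇒≥ r≰d) , (0 , Dist-refl , z≤n)
  ... | yes r≤d with Dist-split r (d ∸ r) (subst (Dist G u w) (sym (m+[n∸m]≡n r≤d)) D)
  ...   | v , D₁ , D₂ = v , (r , Dist-sym symG D₁ , ≤-refl) , (d ∸ r , D₂ , d∸r≤s)
    where
    d∸r≤s : d ∸ r ≤ s
    d∸r≤s = subst (d ∸ r ≤_) (m+n∸m≡n r s) (∸-monoˡ-≤ r d≤r+s)

  -- Distances need not exist constructively; a walk only guarantees one up to double negation.
  walk⇒¬¬Dist : ∀ {u v n} → Walk G u v n → ¬ ¬ (∃ λ m → Dist G u v m)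
  walk⇒¬¬Dist {u} {v} {n} p = go n (<-wellFounded n) p
    where
    go : ∀ n → Acc _<_ n → Walk G u v n → ¬ ¬ (∃ λ m → Dist G u v m)
    go n (acc shorter) p no-dist = no-dist (n , p , minimal)
      where
      minimal : ∀ n′ → Walk G u v n′ → n ≤ n′
      minimal n′ q with n ≤? n′
      ... | yes n≤n′ = n≤n′
      ... | no n≰n′ = ⊥-elim (go n′ (shorter (≰⇒> n≰n′)) q no-dist)

  no-short-Dist⇒walk-> : ∀ {u v L n} → (∀ m → Dist G u v m → m ≤ L → ⊥) → Walk G u v n → L < n
  no-short-Dist⇒walk-> {L = L} {n} no-short p with n ≤? L
  ... | no n≰L = ≰⇒> n≰L
  ... | yes n≤L = ⊥-elim (walk⇒¬¬Dist p λ (m , D) → no-short m D (≤-trans (proj₂ D n p) n≤L))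

  Dist⇒Pow-Adj⇔ : ∀ {u v d ℓ} → Dist G u v d → Adj (Pow G ℓ) u v ⇔ (u ≢ v × d ≤ ℓ)
  Dist⇒Pow-Adj⇔ D = mk⇔ (λ (u≢v , m , D′ , m≤ℓ) → u≢v , subst (_≤ _) (Dist-unique D′ D) m≤ℓ)
                        (λ (u≢v , d≤ℓ) → u≢v , _ , D , d≤ℓ)

  Pow-mono : ∀ {ℓ ℓ′ u v} → ℓ ≤ ℓ′ → Adj (Pow G ℓ) u v → Adj (Pow G ℓ′) u v
  Pow-mono ℓ≤ℓ′ (u≢v , m , D , m≤ℓ) = u≢v , m , D , ≤-trans m≤ℓ ℓ≤ℓ′

  Pow-symmetric : Symmetric G → ∀ {ℓ} → Symmetric (Pow G ℓ)
  Pow-symmetric symG (u≢v , m , D , m≤ℓ) = (λ v≡u → u≢v (sym v≡u)) , m , Dist-sym symG D , m≤ℓ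

  tight-path : ∀ {u v w m₁ m₂ L₁ L₂} → Dist G u v m₁ → m₁ ≤ L₁ → Dist G v w m₂ → m₂ ≤ L₂ →
    (∀ {n} → Walk G u w n → L₁ + L₂ ≤ n) → m₁ ≡ L₁ × m₂ ≡ L₂ × Dist G u w (L₁ + L₂)
  tight-path {m₁ = m₁} {m₂} {L₁} {L₂} (p , _) m₁≤L₁ (q , _) m₂≤L₂ long = m₁≡L₁ , m₂≡L₂
    , subst (Walk G _ _) (cong₂ _+_ m₁≡L₁ m₂≡L₂) (p ++ʷ q) , λ n r → long r
    where
    m₁≡L₁ : m₁ ≡ L₁
    m₁≡L₁ = +-tight m₁≤L₁ m₂≤L₂ (long (p ++ʷ q))
    m₂≡L₂ : m₂ ≡ L₂
    m₂≡L₂ = +-tight m₂≤L₂ m₁≤L₁ (subst₂ _≤_ (+-comm L₁ L₂) (+-comm m₁ m₂) (long (p ++ʷ q)))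

realises-Dist⇒IsometricSubgraph : ∀ {H G} → Irreflexive H → Irreflexive G →
  (f : V H → V G) (d : V H → V H → ℕ) →
  (∀ a b → Dist H a b (d a b)) → (∀ a b → Dist G (f a) (f b) (d a b)) → IsometricSubgraph H G
realises-Dist⇒IsometricSubgraph {H} {G} irrH irrG f d H-Dist G-Dist = f , f-injective , f-Adj , f-Dist
  where
  module H = Walks H
  module G = Walks G
  H-d : ∀ {a b m} → Dist H a b m → d a b ≡ m
  H-d D = H.Dist-unique (H-Dist _ _) D
  G-d : ∀ {a b m} → Dist G (f a) (f b) m → d a b ≡ m
  G-d D = G.Dist-unique (G-Dist _ _) D
  f-injective : ∀ a b → f a ≡ f b → a ≡ b
  f-injective a b eq = H.Dist0⇒≡ (subst (Dist H a b) (G-d (subst (λ v → Dist G (f a) v 0) eq G.Dist-refl)) (H-Dist a b))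
  f-Adj : ∀ a b → Adj H a b ⇔ Adj G (f a) (f b)
  f-Adj a b = mk⇔
    (λ adj → G.walk1⇒Adj (proj₁ (subst (Dist G (f a) (f b)) (H-d (H.Adj⇒Dist1 irrH adj)) (G-Dist a b))))
    (λ adj → H.walk1⇒Adj (proj₁ (subst (Dist H a b) (G-d (G.Adj⇒Dist1 irrG adj)) (H-Dist a b))))
  f-Dist : ∀ a b m → Dist H a b m ⇔ Dist G (f a) (f b) m
  f-Dist a b m = mk⇔ (λ D → subst (Dist G (f a) (f b)) (H-d D) (G-Dist a b)) (λ D → subst (Dist H a b) (G-d D) (H-Dist a b))

record _≅_ (H M : Graph) : Set where
  field
    to      : V H → V M
    from    : V M → V H
    from-to : ∀ a → from (to a) ≡ a
    to-from : ∀ b → to (from b) ≡ b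
    to-Adj  : ∀ a b → Adj H a b ⇔ Adj M (to a) (to b)

  from-Adj : ∀ u v → Adj M u v ⇔ Adj H (from u) (from v)
  from-Adj u v = mk⇔
    (λ adj → Equivalence.from (to-Adj (from u) (from v)) (subst₂ (Adj M) (sym (to-from u)) (sym (to-from v)) adj))
    (λ adj → subst₂ (Adj M) (to-from u) (to-from v) (Equivalence.to (to-Adj (from u) (from v)) adj))

≅-sym : ∀ {H M} → H ≅ M → M ≅ H
≅-sym iso = record
  { to = from ; from = to ; from-to = to-from ; to-from = from-to ; to-Adj = from-Adj }
  where open _≅_ iso

≅-Walk : ∀ {H M} (iso : H ≅ M) → ∀ {a b n} → Walk H a b n → Walk M (_≅_.to iso a) (_≅_.to iso b) n
≅-Walk iso here = here
≅-Walk iso (step adj w) = step (Equivalence.to (_≅_.to-Adj iso _ _) adj) (≅-Walk iso w)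

≅-Dist : ∀ {H M} (iso : H ≅ M) → ∀ a b m → Dist H a b m ⇔ Dist M (_≅_.to iso a) (_≅_.to iso b) m
≅-Dist {H} iso a b m = mk⇔ (λ (w , min) → ≅-Walk iso w , λ n w′ → min n (pull w′))
                           (λ (w , min) → pull w , λ n w′ → min n (≅-Walk iso w′))
  where
  open _≅_ iso
  pull : ∀ {n} → Walk _ (to a) (to b) n → Walk H a b n
  pull {n} w = subst₂ (λ a b → Walk H a b n) (from-to a) (from-to b) (≅-Walk (≅-sym iso) w)

≅-IsometricSubgraph : ∀ {H M G} → H ≅ M → IsometricSubgraph M G → IsometricSubgraph H G
≅-IsometricSubgraph iso (f , f-injective , f-Adj , f-Dist) =
    (λ a → f (to a))
  , (λ a b eq → trans (sym (from-to a)) (trans (cong from (f-injective (to a) (to b) eq)) (from-to b)))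
  , (λ a b → ⇔-trans (to-Adj a b) (f-Adj (to a) (to b)))
  , (λ a b m → ⇔-trans (≅-Dist iso a b m) (f-Dist (to a) (to b) m))
  where open _≅_ iso

IsometricSubgraph-≅ : ∀ {H M G} → H ≅ M → IsometricSubgraph H G ⇔ IsometricSubgraph M G
IsometricSubgraph-≅ iso = mk⇔ (≅-IsometricSubgraph (≅-sym iso)) (≅-IsometricSubgraph iso)

-- The Chebyshev metric and king steps

Point : Set
Point = ℕ × ℕ

cheb : Point → Point → ℕ
cheb (x , y) (x′ , y′) = ∣ x - x′ ∣ ⊔ ∣ y - y′ ∣

cheb-sym : ∀ p q → cheb p q ≡ cheb q p
cheb-sym (x , y) (x′ , y′) = cong₂ _⊔_ (∣-∣-comm x x′) (∣-∣-comm y y′)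

cheb-self : ∀ p → cheb p p ≡ 0
cheb-self (x , y) = cong₂ _⊔_ (∣n-n∣≡0 x) (∣n-n∣≡0 y)

cheb≡0⇒≡ : ∀ {p q} → cheb p q ≡ 0 → p ≡ q
cheb≡0⇒≡ {x , y} {x′ , y′} eq =
  cong₂ _,_ (∣m-n∣≡0⇒m≡n (n≤0⇒n≡0 (≤-trans (m≤m⊔n ∣ x - x′ ∣ ∣ y - y′ ∣) (≤-reflexive eq))))
            (∣m-n∣≡0⇒m≡n (n≤0⇒n≡0 (≤-trans (m≤n⊔m ∣ x - x′ ∣ ∣ y - y′ ∣) (≤-reflexive eq))))

cheb-triangle : ∀ p q r → cheb p r ≤ cheb p q + cheb q r
cheb-triangle (a , b) (c , d) (e , f) = ⊔-lub
  (≤-trans (∣-∣-triangle a c e) (m≤m⊔n ∣ a - c ∣ ∣ b - d ∣ ⊕ m≤m⊔n ∣ c - e ∣ ∣ d - f ∣))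
  (≤-trans (∣-∣-triangle b d f) (m≤n⊔m ∣ a - c ∣ ∣ b - d ∣ ⊕ m≤n⊔m ∣ c - e ∣ ∣ d - f ∣))

data Toward (x y : ℕ) : ℕ → Set where
  up   : x < y → Toward x y (suc x)
  stay : x ≡ y → Toward x y x
  down : ∀ {x′} → suc x′ ≡ x → y ≤ x′ → Toward x y x′

toward : ℕ → ℕ → ℕ
toward x y with <-cmp x y
... | tri< _ _ _ = suc x
... | tri≈ _ _ _ = x
... | tri> _ _ _ = pred x

toward-spec : ∀ x y → Toward x y (toward x y)
toward-spec x y with <-cmp x y
... | tri< x<y _ _ = up x<y
... | tri≈ _ x≡y _ = stay x≡y
toward-spec (suc x) y | tri> _ _ (s≤s y≤x) = down refl y≤x

Toward⇒∣-∣≤1 : ∀ {x y x′} → Toward x y x′ → ∣ x - x′ ∣ ≤ 1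
Toward⇒∣-∣≤1 {x} (up _) = ≤-reflexive (∣n-1+n∣≡1 x)
Toward⇒∣-∣≤1 {x} (stay _) = subst (_≤ 1) (sym (∣n-n∣≡0 x)) z≤n
Toward⇒∣-∣≤1 (down {x′} refl _) = ≤-reflexive (∣1+n-n∣≡1 x′)

Toward⇒∣-∣≡1 : ∀ {x y x′} → Toward x y x′ → x ≢ y → ∣ x - x′ ∣ ≡ 1
Toward⇒∣-∣≡1 {x} (up _) _ = ∣n-1+n∣≡1 x
Toward⇒∣-∣≡1 (stay x≡y) x≢y = ⊥-elim (x≢y x≡y)
Toward⇒∣-∣≡1 (down {x′} refl _) _ = ∣1+n-n∣≡1 x′

Toward-closer : ∀ {x y x′} → Toward x y x′ → ∣ x′ - y ∣ ≡ ∣ x - y ∣ ∸ 1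
Toward-closer {x} {y} (up x<y) = begin
  ∣ suc x - y ∣  ≡⟨ m≤n⇒∣m-n∣≡n∸m x<y ⟩
  y ∸ suc x      ≡⟨ cong (y ∸_) (+-comm 1 x) ⟩
  y ∸ (x + 1)    ≡⟨ ∸-+-assoc y x 1 ⟨
  y ∸ x ∸ 1      ≡⟨ cong (_∸ 1) (m≤n⇒∣m-n∣≡n∸m (<⇒≤ x<y)) ⟨
  ∣ x - y ∣ ∸ 1  ∎
  where open ≡-Reasoning
Toward-closer {x} (stay refl) = trans (∣n-n∣≡0 x) (cong (_∸ 1) (sym (∣n-n∣≡0 x)))
Toward-closer {y = y} (down {x′} refl y≤x′) = begin
  ∣ x′ - y ∣         ≡⟨ m≤n⇒∣n-m∣≡n∸m y≤x′ ⟩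
  x′ ∸ y             ≡⟨ cong (_∸ 1) (+-∸-assoc 1 y≤x′) ⟨
  suc x′ ∸ y ∸ 1     ≡⟨ cong (_∸ 1) (m≤n⇒∣n-m∣≡n∸m (m≤n⇒m≤1+n y≤x′)) ⟨
  ∣ suc x′ - y ∣ ∸ 1 ∎
  where open ≡-Reasoning

-- A king step from (x , y) toward (x₁ , y₁) leaves each of x + y and y − x weakly between its
-- values at the two endpoints; the four lemmas state this in ℕ, one inequality at a time.
Toward-sum-≥ : ∀ {x y x₁ y₁ x′ y′} → Toward x x₁ x′ → Toward y y₁ y′ →
  (x + y ≤ x′ + y′) ⊎ (x₁ + y₁ ≤ x′ + y′)
Toward-sum-≥ {x} {y} (up _) (up _) = inj₁ (≤-by-certificate (z≤n {2}) (solve (x ∷ y ∷ [])))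
Toward-sum-≥ {x} {y} (up _) (stay refl) = inj₁ (≤-by-certificate (z≤n {1}) (solve (x ∷ y ∷ [])))
Toward-sum-≥ {x} {y′ = y′} (up _) (down refl _) = inj₁ (≤-by-certificate (z≤n {0}) (solve (x ∷ y′ ∷ [])))
Toward-sum-≥ {x} {y} (stay refl) (up _) = inj₁ (≤-by-certificate (z≤n {1}) (solve (x ∷ y ∷ [])))
Toward-sum-≥ (stay refl) (stay refl) = inj₁ ≤-refl
Toward-sum-≥ {x} (stay refl) (down refl h) = inj₂ (+-monoʳ-≤ x h)
Toward-sum-≥ {y = y} {x′ = x′} (down refl _) (up _) = inj₁ (≤-by-certificate (z≤n {0}) (solve (x′ ∷ y ∷ [])))
Toward-sum-≥ {y = y} (down refl h) (stay refl) = inj₂ (+-monoˡ-≤ y h)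
Toward-sum-≥ (down refl h) (down refl h′) = inj₂ (h ⊕ h′)

Toward-sum-≤ : ∀ {x y x₁ y₁ x′ y′} → Toward x x₁ x′ → Toward y y₁ y′ →
  (x′ + y′ ≤ x + y) ⊎ (x′ + y′ ≤ x₁ + y₁)
Toward-sum-≤ (up h) (up h′) = inj₂ (h ⊕ h′)
Toward-sum-≤ {y = y} (up h) (stay refl) = inj₂ (+-monoˡ-≤ y h)
Toward-sum-≤ {x} {y′ = y′} (up _) (down refl _) = inj₁ (≤-by-certificate (z≤n {0}) (solve (x ∷ y′ ∷ [])))
Toward-sum-≤ {x} (stay refl) (up h) = inj₂ (+-monoʳ-≤ x h)
Toward-sum-≤ (stay refl) (stay refl) = inj₁ ≤-refl
Toward-sum-≤ {x} {y′ = y′} (stay refl) (down refl _) = inj₁ (≤-by-certificate (z≤n {1}) (solve (x ∷ y′ ∷ [])))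
Toward-sum-≤ {y = y} {x′ = x′} (down refl _) (up _) = inj₁ (≤-by-certificate (z≤n {0}) (solve (x′ ∷ y ∷ [])))
Toward-sum-≤ {y = y} {x′ = x′} (down refl _) (stay refl) = inj₁ (≤-by-certificate (z≤n {1}) (solve (x′ ∷ y ∷ [])))
Toward-sum-≤ {x′ = x′} {y′} (down refl _) (down refl _) = inj₁ (≤-by-certificate (z≤n {2}) (solve (x′ ∷ y′ ∷ [])))

Toward-skew-≤ : ∀ {x y x₁ y₁ x′ y′} → Toward x x₁ x′ → Toward y y₁ y′ →
  (y′ + x ≤ x′ + y) ⊎ (y′ + x₁ ≤ x′ + y₁)
Toward-skew-≤ {x} {y} (up _) (up _) = inj₁ (≤-by-certificate (z≤n {0}) (solve (x ∷ y ∷ [])))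
Toward-skew-≤ {x} {y} (up _) (stay refl) = inj₁ (≤-by-certificate (z≤n {1}) (solve (x ∷ y ∷ [])))
Toward-skew-≤ {x} {y′ = y′} (up _) (down refl _) = inj₁ (≤-by-certificate (z≤n {2}) (solve (x ∷ y′ ∷ [])))
Toward-skew-≤ {x} {y} {y₁ = y₁} (stay refl) (up h) = inj₂ (≤-by-certificate h (solve (x ∷ y ∷ y₁ ∷ [])))
Toward-skew-≤ {x} {y} (stay refl) (stay refl) = inj₁ (≤-by-certificate (z≤n {0}) (solve (x ∷ y ∷ [])))
Toward-skew-≤ {x} {y′ = y′} (stay refl) (down refl _) = inj₁ (≤-by-certificate (z≤n {1}) (solve (x ∷ y′ ∷ [])))
Toward-skew-≤ {y = y} {x₁} {y₁} {x′} (down refl h) (up h′) = inj₂ (≤-by-certificate (h ⊕ h′) (solve (x′ ∷ y ∷ x₁ ∷ y₁ ∷ [])))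
Toward-skew-≤ {y = y} {x₁} {x′ = x′} (down refl h) (stay refl) = inj₂ (≤-by-certificate h (solve (x′ ∷ y ∷ x₁ ∷ [])))
Toward-skew-≤ {x′ = x′} {y′} (down refl _) (down refl _) = inj₁ (≤-by-certificate (z≤n {0}) (solve (x′ ∷ y′ ∷ [])))

Toward-skew-≥ : ∀ {x y x₁ y₁ x′ y′} → Toward x x₁ x′ → Toward y y₁ y′ →
  (x′ + y ≤ y′ + x) ⊎ (x′ + y₁ ≤ y′ + x₁)
Toward-skew-≥ {x} {y} (up _) (up _) = inj₁ (≤-by-certificate (z≤n {0}) (solve (x ∷ y ∷ [])))
Toward-skew-≥ {x} {y} {x₁} (up h) (stay refl) = inj₂ (≤-by-certificate h (solve (x ∷ y ∷ x₁ ∷ [])))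
Toward-skew-≥ {x} {_} {x₁} {y₁} {y′ = y′} (up h) (down refl h′) = inj₂ (≤-by-certificate (h ⊕ h′) (solve (x ∷ y′ ∷ x₁ ∷ y₁ ∷ [])))
Toward-skew-≥ {x} {y} (stay refl) (up _) = inj₁ (≤-by-certificate (z≤n {1}) (solve (x ∷ y ∷ [])))
Toward-skew-≥ {x} {y} (stay refl) (stay refl) = inj₁ (≤-by-certificate (z≤n {0}) (solve (x ∷ y ∷ [])))
Toward-skew-≥ {x} {_} {y₁ = y₁} {y′ = y′} (stay refl) (down refl h) = inj₂ (≤-by-certificate h (solve (x ∷ y′ ∷ y₁ ∷ [])))
Toward-skew-≥ {y = y} {x′ = x′} (down refl _) (up _) = inj₁ (≤-by-certificate (z≤n {2}) (solve (x′ ∷ y ∷ [])))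
Toward-skew-≥ {y = y} {x′ = x′} (down refl _) (stay refl) = inj₁ (≤-by-certificate (z≤n {1}) (solve (x′ ∷ y ∷ [])))
Toward-skew-≥ {x′ = x′} {y′} (down refl _) (down refl _) = inj₁ (≤-by-certificate (z≤n {0}) (solve (x′ ∷ y′ ∷ [])))

kingStep : Point → Point → Point
kingStep (x , y) (x₁ , y₁) = toward x x₁ , toward y y₁

kingStep-adjacent : ∀ p q → p ≢ q → cheb p (kingStep p q) ≡ 1
kingStep-adjacent (x , y) (x₁ , y₁) p≢q =
  ⊔≡1 (Toward⇒∣-∣≤1 tx) (Toward⇒∣-∣≤1 ty) (map-⊎ (Toward⇒∣-∣≡1 tx) (Toward⇒∣-∣≡1 ty) moved)
  where
  tx : Toward x x₁ (toward x x₁)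
  tx = toward-spec x x₁
  ty : Toward y y₁ (toward y y₁)
  ty = toward-spec y y₁
  moved : x ≢ x₁ ⊎ y ≢ y₁
  moved with x ≟ x₁ | y ≟ y₁
  ... | no x≢x₁ | _ = inj₁ x≢x₁
  ... | yes _ | no y≢y₁ = inj₂ y≢y₁
  ... | yes refl | yes refl = ⊥-elim (p≢q refl)

kingStep-closer : ∀ p q → cheb (kingStep p q) q ≡ cheb p q ∸ 1
kingStep-closer (x , y) (x₁ , y₁) = begin
  ∣ toward x x₁ - x₁ ∣ ⊔ ∣ toward y y₁ - y₁ ∣
    ≡⟨ cong₂ _⊔_ (Toward-closer (toward-spec x x₁)) (Toward-closer (toward-spec y y₁)) ⟩
  (∣ x - x₁ ∣ ∸ 1) ⊔ (∣ y - y₁ ∣ ∸ 1)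
    ≡⟨ ∸-distribʳ-⊔ 1 ∣ x - x₁ ∣ ∣ y - y₁ ∣ ⟨
  cheb (x , y) (x₁ , y₁) ∸ 1 ∎
  where open ≡-Reasoning

Aligned : Point → Point → Point → Set
Aligned c p q = (cheb c q ≡ cheb c p + cheb p q) ⊎ (cheb c p ≡ cheb c q + cheb p q)

Aligned-by-coordinate : ∀ {c p q a b} → cheb c p ≡ a → cheb c q ≡ b → cheb p q ≡ ∣ a - b ∣ → Aligned c p q
Aligned-by-coordinate {c} {p} {q} refl refl pq≡ =
  subst (λ d → (cheb c q ≡ cheb c p + d) ⊎ (cheb c p ≡ cheb c q + d)) (sym pq≡)
        (∣-∣-additive (cheb c p) (cheb c q))

-- The model of H₂ᵏ

-- H₂ᵏ translated by (1 , k): Rect is its part 0 ≤ s ≤ 2k + 1, −1 ≤ t ≤ 2k, and pA, pC are its two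
-- extra vertices; pB and pD are the other two corners of the rectangle.
module Model (k : ℕ) where

  Rect : Point → Set
  Rect (x , y) = (suc k ≤ x + y) × (x + y ≤ 3 * k + 2) × (y ≤ x + k) × (x ≤ y + suc k)

  pA pB pC pD : Point
  pA = 0 , k
  pB = suc k , 0
  pC = 2 * k + 2 , suc k
  pD = suc k , 2 * k + 1

  InModel : Point → Set
  InModel p = Rect p ⊎ p ≡ pA ⊎ p ≡ pC

  Model : Graph
  Model = record { V = Σ Point InModel ; Adj = λ a b → cheb (proj₁ a) (proj₁ b) ≡ 1 }

  VM : Set
  VM = V Model

  chebᴹ : VM → VM → ℕ
  chebᴹ a b = cheb (proj₁ a) (proj₁ b)

  ¬Rect-pA : ¬ Rect pA
  ¬Rect-pA (k<k , _) = 1+n≰n k<k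

  ¬Rect-pC : ¬ Rect pC
  ¬Rect-pC (_ , C≤ , _) = 1+n≰n (≤-trans (≤-reflexive sum≡) C≤)
    where
    sum≡ : suc (3 * k + 2) ≡ 2 * k + 2 + suc k
    sum≡ = solve (k ∷ [])

  pA≢pC : pA ≢ pC
  pA≢pC eq = 0≢1+n (trans (cong proj₁ eq) (+-comm (2 * k) 2))

  Rect-irrelevant : ∀ {p} (r r′ : Rect p) → r ≡ r′
  Rect-irrelevant (a , b , c , d) (a′ , b′ , c′ , d′) =
    cong₂ _,_ (≤-irrelevant a a′) (cong₂ _,_ (≤-irrelevant b b′) (cong₂ _,_ (≤-irrelevant c c′) (≤-irrelevant d d′)))

  Point-uip : ∀ {p q : Point} (e e′ : p ≡ q) → e ≡ e′
  Point-uip = Decidable⇒UIP.≡-irrelevant (≡-dec _≟_ _≟_)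

  InModel-irrelevant : ∀ {p} (i j : InModel p) → i ≡ j
  InModel-irrelevant (inj₁ r) (inj₁ r′) = cong inj₁ (Rect-irrelevant r r′)
  InModel-irrelevant (inj₁ r) (inj₂ (inj₁ refl)) = ⊥-elim (¬Rect-pA r)
  InModel-irrelevant (inj₁ r) (inj₂ (inj₂ refl)) = ⊥-elim (¬Rect-pC r)
  InModel-irrelevant (inj₂ (inj₁ refl)) (inj₁ r) = ⊥-elim (¬Rect-pA r)
  InModel-irrelevant (inj₂ (inj₂ refl)) (inj₁ r) = ⊥-elim (¬Rect-pC r)
  InModel-irrelevant (inj₂ (inj₁ e)) (inj₂ (inj₁ e′)) = cong (λ e → inj₂ (inj₁ e)) (Point-uip e e′)
  InModel-irrelevant (inj₂ (inj₂ e)) (inj₂ (inj₂ e′)) = cong (λ e → inj₂ (inj₂ e)) (Point-uip e e′)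
  InModel-irrelevant (inj₂ (inj₁ refl)) (inj₂ (inj₂ e)) = ⊥-elim (pA≢pC e)
  InModel-irrelevant (inj₂ (inj₂ refl)) (inj₂ (inj₁ e)) = ⊥-elim (pA≢pC (sym e))

  ≡⇒≡ᴹ : ∀ {a b : VM} → proj₁ a ≡ proj₁ b → a ≡ b
  ≡⇒≡ᴹ {p , i} {.p , j} refl = cong (p ,_) (InModel-irrelevant i j)

  Model-symmetric : Symmetric Model
  Model-symmetric {a} {b} adj = trans (cheb-sym (proj₁ b) (proj₁ a)) adj

  Model-irreflexive : Irreflexive Model
  Model-irreflexive {a} adj = 0≢1+n (trans (sym (cheb-self (proj₁ a))) adj)

  Rect? : ∀ p → Dec (Rect p)
  Rect? (x , y) = suc k ≤? x + y ×-dec x + y ≤? 3 * k + 2 ×-dec y ≤? x + k ×-dec x ≤? y + suc k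

  Model-walk-≥-cheb : ∀ {a b n} → Walk Model a b n → chebᴹ a b ≤ n
  Model-walk-≥-cheb {a} here = ≤-reflexive (cheb-self (proj₁ a))
  Model-walk-≥-cheb {a} {b} (step {v = c} a~c w) =
    ≤-trans (cheb-triangle (proj₁ a) (proj₁ c) (proj₁ b))
            (subst (λ d → d + chebᴹ c b ≤ _) (sym a~c) (s≤s (Model-walk-≥-cheb w)))

  -- The rectangle is cut out by bounds on x + y and y − x, which a king step respects.
  Rect-toward : ∀ {x y x₁ y₁ x′ y′} → Toward x x₁ x′ → Toward y y₁ y′ →
    Rect (x , y) → Rect (x₁ , y₁) → Rect (x′ , y′)
  Rect-toward {x} {y} {x₁} {y₁} {x′} {y′} tx ty (r₁ , r₂ , r₃ , r₄) (q₁ , q₂ , q₃ , q₄) = c₁ , c₂ , c₃ , c₄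
    where
    c₁ : suc k ≤ x′ + y′
    c₁ with Toward-sum-≥ tx ty
    ... | inj₁ h = ≤-trans r₁ h
    ... | inj₂ h = ≤-trans q₁ h
    c₂ : x′ + y′ ≤ 3 * k + 2
    c₂ with Toward-sum-≤ tx ty
    ... | inj₁ h = ≤-trans h r₂
    ... | inj₂ h = ≤-trans h q₂
    c₃ : y′ ≤ x′ + k
    c₃ with Toward-skew-≤ tx ty
    ... | inj₁ h = ≤-by-certificate (h ⊕ r₃) (solve (x ∷ y ∷ x′ ∷ y′ ∷ k ∷ []))
    ... | inj₂ h = ≤-by-certificate (h ⊕ q₃) (solve (x₁ ∷ y₁ ∷ x′ ∷ y′ ∷ k ∷ []))
    c₄ : x′ ≤ y′ + suc k
    c₄ with Toward-skew-≥ tx ty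
    ... | inj₁ h = ≤-by-certificate (h ⊕ r₄) (solve (x ∷ y ∷ x′ ∷ y′ ∷ k ∷ []))
    ... | inj₂ h = ≤-by-certificate (h ⊕ q₄) (solve (x₁ ∷ y₁ ∷ x′ ∷ y′ ∷ k ∷ []))

  Rect-kingStep : ∀ {p q} → Rect p → Rect q → Rect (kingStep p q)
  Rect-kingStep {x , y} {x₁ , y₁} = Rect-toward (toward-spec x x₁) (toward-spec y y₁)

  Rect-geodesic : ∀ n {p q} (rp : Rect p) (rq : Rect q) → cheb p q ≡ n →
    Walk Model (p , inj₁ rp) (q , inj₁ rq) n
  Rect-geodesic zero rp rq pq≡0 = subst (λ b → Walk Model (_ , inj₁ rp) b 0) (≡⇒≡ᴹ (cheb≡0⇒≡ pq≡0)) here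
  Rect-geodesic (suc n) {p} {q} rp rq pq≡1+n =
    step (kingStep-adjacent p q p≢q)
         (Rect-geodesic n (Rect-kingStep rp rq) rq (trans (kingStep-closer p q) (cong (_∸ 1) pq≡1+n)))
    where
    p≢q : p ≢ q
    p≢q refl = 0≢1+n (trans (sym (cheb-self p)) pq≡1+n)

  module _ {x y : ℕ} (r : Rect (x , y)) where
    private
      r₁ : suc k ≤ x + y
      r₁ = proj₁ r
      r₂ : x + y ≤ 3 * k + 2
      r₂ = proj₁ (proj₂ r)
      r₃ : y ≤ x + k
      r₃ = proj₁ (proj₂ (proj₂ r))
      r₄ : x ≤ y + suc k
      r₄ = proj₂ (proj₂ (proj₂ r))

    Rect⇒x≤2k+1 : x ≤ 2 * k + 1
    Rect⇒x≤2k+1 with x ≤? 2 * k + 1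
    ... | yes x≤ = x≤
    ... | no x≰ = ⊥-elim (1+n≰n {0} (≤-by-certificate (≰⇒> x≰ ⊕ ≰⇒> x≰ ⊕ r₄ ⊕ r₂) (solve (x ∷ y ∷ k ∷ []))))

    Rect⇒y≤2k+1 : y ≤ 2 * k + 1
    Rect⇒y≤2k+1 with y ≤? 2 * k + 1
    ... | yes y≤ = y≤
    ... | no y≰ = ⊥-elim (1+n≰n {0} (≤-by-certificate (≰⇒> y≰ ⊕ ≰⇒> y≰ ⊕ r₃ ⊕ r₂ ⊕ z≤n {1}) (solve (x ∷ y ∷ k ∷ []))))

    cheb-pA : cheb pA (x , y) ≡ x
    cheb-pA = m≥n⇒m⊔n≡m (≤⇒∣-∣≤ k y x (≤-by-certificate (r₁ ⊕ z≤n {1}) (solve (x ∷ y ∷ k ∷ [])))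
                                 (≤-by-certificate r₃ (solve (x ∷ y ∷ k ∷ []))))

    cheb-pB : cheb pB (x , y) ≡ y
    cheb-pB = m≤n⇒m⊔n≡n (≤⇒∣-∣≤ (suc k) x y (≤-by-certificate r₁ (solve (x ∷ y ∷ k ∷ [])))
                                 (≤-by-certificate r₄ (solve (x ∷ y ∷ k ∷ []))))

    cheb-pC : cheb pC (x , y) + x ≡ 2 * k + 2
    cheb-pC with m≤n⇒∃[o]m+o≡n Rect⇒x≤2k+1
    ... | e , x+e≡2k+1 = begin
      cheb pC (x , y) + x ≡⟨ cong (_+ x) (trans (cong (_⊔ ∣ suc k - y ∣) x-part) (m≥n⇒m⊔n≡m y-part)) ⟩
      suc e + x           ≡⟨ cong suc (+-comm e x) ⟩
      suc (x + e)         ≡⟨ cong suc x+e≡2k+1 ⟩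
      suc (2 * k + 1)     ≡⟨ +-suc (2 * k) 1 ⟨
      2 * k + 2           ∎
      where
      open ≡-Reasoning
      x+e≤ : 2 * k + 1 ≤ x + e
      x+e≤ = ≤-reflexive (sym x+e≡2k+1)
      x-part : ∣ 2 * k + 2 - x ∣ ≡ suc e
      x-part = +≡⇒∣-∣≡ (trans (+-suc x e) (trans (cong suc x+e≡2k+1) (sym (+-suc (2 * k) 1))))
      y-part : ∣ suc k - y ∣ ≤ suc e
      y-part = ≤⇒∣-∣≤ (suc k) y (suc e) (≤-by-certificate (r₄ ⊕ x+e≤) (solve (x ∷ y ∷ k ∷ e ∷ [])))
                      (≤-by-certificate (r₂ ⊕ x+e≤ ⊕ z≤n {1}) (solve (x ∷ y ∷ k ∷ e ∷ [])))

    cheb-pD : cheb pD (x , y) + y ≡ 2 * k + 1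
    cheb-pD with m≤n⇒∃[o]m+o≡n Rect⇒y≤2k+1
    ... | e , y+e≡2k+1 = begin
      cheb pD (x , y) + y ≡⟨ cong (_+ y) (trans (cong (∣ suc k - x ∣ ⊔_) y-part) (m≤n⇒m⊔n≡n x-part)) ⟩
      e + y               ≡⟨ +-comm e y ⟩
      y + e               ≡⟨ y+e≡2k+1 ⟩
      2 * k + 1           ∎
      where
      open ≡-Reasoning
      y+e≤ : 2 * k + 1 ≤ y + e
      y+e≤ = ≤-reflexive (sym y+e≡2k+1)
      y-part : ∣ 2 * k + 1 - y ∣ ≡ e
      y-part = +≡⇒∣-∣≡ y+e≡2k+1
      x-part : ∣ suc k - x ∣ ≤ e
      x-part = ≤⇒∣-∣≤ (suc k) x e (≤-by-certificate (r₃ ⊕ y+e≤) (solve (x ∷ y ∷ k ∷ e ∷ [])))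
                      (≤-by-certificate (r₂ ⊕ y+e≤) (solve (x ∷ y ∷ k ∷ e ∷ [])))

  Rect-1k : Rect (1 , k)
  Rect-1k = ≤-refl , ≤-by-certificate (z≤n {2 * k + 1}) (solve (k ∷ [])) , n≤1+n k
                   , ≤-by-certificate (z≤n {2 * k}) (solve (k ∷ []))

  Rect-pB : Rect (suc k , 0)
  Rect-pB = ≤-by-certificate (z≤n {0}) (solve (k ∷ [])) , ≤-by-certificate (z≤n {2 * k + 1}) (solve (k ∷ []))
          , z≤n , ≤-by-certificate (z≤n {0}) (solve (k ∷ []))

  Rect-pD : Rect (suc k , 2 * k + 1)
  Rect-pD = ≤-by-certificate (z≤n {2 * k + 1}) (solve (k ∷ [])) , ≤-by-certificate (z≤n {0}) (solve (k ∷ []))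
          , ≤-by-certificate (z≤n {0}) (solve (k ∷ [])) , ≤-by-certificate (z≤n {2 * k + 1}) (solve (k ∷ []))

  cheb-pA-pC : cheb pA pC ≡ 2 * k + 2
  cheb-pA-pC = trans (cong (2 * k + 2 ⊔_) (∣n-1+n∣≡1 k)) (m≥n⇒m⊔n≡m (≤-by-certificate (z≤n {2 * k + 1}) (solve (k ∷ []))))

  geodesic-via : ∀ (a r b : VM) → Adj Model a r → suc (chebᴹ r b) ≤ chebᴹ a b →
    Walk Model r b (chebᴹ r b) → Walk Model a b (chebᴹ a b)
  geodesic-via a r b a~r closer w = subst (Walk Model a b) length (step a~r w)
    where
    length : suc (chebᴹ r b) ≡ chebᴹ a b
    length = ≤-antisym closer
      (subst (λ d → chebᴹ a b ≤ d + chebᴹ r b) a~r (cheb-triangle (proj₁ a) (proj₁ r) (proj₁ b)))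

  Closer-neighbour : Point → Point → Set
  Closer-neighbour c q = Σ Point λ r → Rect r × cheb c r ≡ 1 × suc (cheb r q) ≤ cheb c q

  pA-neighbour : ∀ {q} → Rect q → Closer-neighbour pA q
  pA-neighbour {zero , _} (k<y , _ , y≤k , _) = ⊥-elim (1+n≰n (≤-trans k<y y≤k))
  pA-neighbour {suc x , y} rq@(q₁ , _ , q₃ , _) with y ≤? x + k
  ... | yes y≤x+k = (1 , k) , Rect-1k , cong (1 ⊔_) (∣n-n∣≡0 k) , closer
    where
    closer : suc (cheb (1 , k) (suc x , y)) ≤ cheb pA (suc x , y)
    closer = subst (suc (cheb (1 , k) (suc x , y)) ≤_) (sym (cheb-pA rq)) (s≤s (⊔-lub ≤-refl
      (≤⇒∣-∣≤ k y x (≤-by-certificate q₁ (solve (x ∷ y ∷ k ∷ [])))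
              (≤-by-certificate y≤x+k (solve (x ∷ y ∷ k ∷ []))))))
  ... | no y≰x+k = (1 , suc k) , rect , cong (1 ⊔_) (∣n-1+n∣≡1 k) , closer
    where
    rect : Rect (1 , suc k)
    rect = n≤1+n (suc k) , ≤-by-certificate (z≤n {2 * k}) (solve (k ∷ [])) , ≤-refl
                         , ≤-by-certificate (z≤n {2 * k + 1}) (solve (k ∷ []))
    closer : suc (cheb (1 , suc k) (suc x , y)) ≤ cheb pA (suc x , y)
    closer = subst (suc (cheb (1 , suc k) (suc x , y)) ≤_) (sym (cheb-pA rq)) (s≤s (⊔-lub ≤-refl
      (≤⇒∣-∣≤ (suc k) y x (≤-by-certificate (≰⇒> y≰x+k ⊕ z≤n {x + x}) (solve (x ∷ y ∷ k ∷ [])))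
              (≤-by-certificate q₃ (solve (x ∷ y ∷ k ∷ []))))))

  pC-neighbour : ∀ {q} → Rect q → Closer-neighbour pC q
  pC-neighbour {x , y} rq@(_ , q₂ , _ , q₄) with m≤n⇒∃[o]m+o≡n (Rect⇒x≤2k+1 rq)
  ... | e , x+e≡2k+1 = neighbour (x ≤? y + k)
    where
    x+e≤ : 2 * k + 1 ≤ x + e
    x+e≤ = ≤-reflexive (sym x+e≡2k+1)
    x+e≥ : x + e ≤ 2 * k + 1
    x+e≥ = ≤-reflexive x+e≡2k+1
    pC-dist : cheb pC (x , y) ≡ suc e
    pC-dist = +-cancelʳ-≡ x _ _ (trans (cheb-pC rq)
      (sym (trans (cong suc (trans (+-comm e x) x+e≡2k+1)) (sym (+-suc (2 * k) 1)))))
    closer : ∀ y′ → ∣ y′ - y ∣ ≤ e → suc (cheb (2 * k + 1 , y′) (x , y)) ≤ cheb pC (x , y)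
    closer y′ y-part = subst (suc (cheb (2 * k + 1 , y′) (x , y)) ≤_) (sym pC-dist)
                             (s≤s (⊔-lub (≤-reflexive (+≡⇒∣-∣≡ x+e≡2k+1)) y-part))
    pC~ : ∀ y′ → ∣ suc k - y′ ∣ ≤ 1 → cheb pC (2 * k + 1 , y′) ≡ 1
    pC~ y′ h = trans (cong (λ v → ∣ v - 2 * k + 1 ∣ ⊔ ∣ suc k - y′ ∣) (+-suc (2 * k) 1))
                       (trans (cong (_⊔ ∣ suc k - y′ ∣) (∣1+n-n∣≡1 (2 * k + 1))) (m≥n⇒m⊔n≡m h))
    neighbour : Dec (x ≤ y + k) → Closer-neighbour pC (x , y)
    neighbour (yes x≤y+k) =
      (2 * k + 1 , suc k) , rect , pC~ (suc k) (subst (_≤ 1) (sym (∣n-n∣≡0 (suc k))) z≤n) , closer (suc k) y-part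
      where
      rect : Rect (2 * k + 1 , suc k)
      rect = ≤-by-certificate (z≤n {2 * k + 1}) (solve (k ∷ [])) , ≤-by-certificate (z≤n {0}) (solve (k ∷ []))
           , ≤-by-certificate (z≤n {2 * k}) (solve (k ∷ [])) , ≤-by-certificate (z≤n {1}) (solve (k ∷ []))
      y-part : ∣ suc k - y ∣ ≤ e
      y-part = ≤⇒∣-∣≤ (suc k) y e (≤-by-certificate (x≤y+k ⊕ x+e≤) (solve (x ∷ y ∷ k ∷ e ∷ [])))
                      (≤-by-certificate (q₂ ⊕ x+e≤) (solve (x ∷ y ∷ k ∷ e ∷ [])))
    neighbour (no x≰y+k) = (2 * k + 1 , k) , rect , pC~ k (≤-reflexive (∣1+n-n∣≡1 k)) , closer k y-part
      where
      rect : Rect (2 * k + 1 , k)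
      rect = ≤-by-certificate (z≤n {2 * k}) (solve (k ∷ [])) , ≤-by-certificate (z≤n {1}) (solve (k ∷ []))
           , ≤-by-certificate (z≤n {2 * k + 1}) (solve (k ∷ [])) , ≤-by-certificate (z≤n {0}) (solve (k ∷ []))
      y-part : ∣ k - y ∣ ≤ e
      y-part = ≤⇒∣-∣≤ k y e (≤-by-certificate (q₄ ⊕ x+e≤) (solve (x ∷ y ∷ k ∷ e ∷ [])))
                      (≤-by-certificate (≰⇒> x≰y+k ⊕ x+e≥ ⊕ z≤n {e + e}) (solve (x ∷ y ∷ k ∷ e ∷ [])))

  vA vC : VM
  vA = pA , inj₂ (inj₁ refl)
  vC = pC , inj₂ (inj₂ refl)

  geodesic-from : ∀ (c : VM) → (∀ {q} → Rect q → Closer-neighbour (proj₁ c) q) →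
    ∀ {q} (rq : Rect q) → Walk Model c (q , inj₁ rq) (cheb (proj₁ c) q)
  geodesic-from c neighbour rq with neighbour rq
  ... | r , rr , c~r , closer = geodesic-via c (r , inj₁ rr) (_ , inj₁ rq) c~r closer (Rect-geodesic _ rr rq refl)

  reverse-geodesic : ∀ {a b} → Walk Model a b (chebᴹ a b) → Walk Model b a (chebᴹ b a)
  reverse-geodesic {a} {b} w =
    subst (Walk Model b a) (cheb-sym (proj₁ a) (proj₁ b)) (reverseʷ (λ {a} {b} → Model-symmetric {a} {b}) w)
    where open Walks Model

  pA-pC-geodesic : Walk Model vA vC (chebᴹ vA vC)
  pA-pC-geodesic = geodesic-via vA (_ , inj₁ Rect-1k) vC (cong (1 ⊔_) (∣n-n∣≡0 k)) closer
                                (reverse-geodesic (geodesic-from vC pC-neighbour Rect-1k))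
    where
    closer : suc (cheb (1 , k) pC) ≤ cheb pA pC
    closer = ≤-reflexive (begin
      suc (cheb (1 , k) pC) ≡⟨ cong suc (cheb-sym (1 , k) pC) ⟩
      suc (cheb pC (1 , k)) ≡⟨ +-comm 1 _ ⟩
      cheb pC (1 , k) + 1   ≡⟨ cheb-pC Rect-1k ⟩
      2 * k + 2             ≡⟨ cheb-pA-pC ⟨
      cheb pA pC            ∎)
      where open ≡-Reasoning

  Model-geodesic : ∀ a b → Walk Model a b (chebᴹ a b)
  Model-geodesic (_ , inj₁ rp) (_ , inj₁ rq) = Rect-geodesic _ rp rq refl
  Model-geodesic (_ , inj₂ (inj₁ refl)) (_ , inj₁ rq) = geodesic-from vA pA-neighbour rq
  Model-geodesic (_ , inj₂ (inj₂ refl)) (_ , inj₁ rq) = geodesic-from vC pC-neighbour rq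
  Model-geodesic (_ , inj₁ rp) (_ , inj₂ (inj₁ refl)) = reverse-geodesic (geodesic-from vA pA-neighbour rp)
  Model-geodesic (_ , inj₁ rp) (_ , inj₂ (inj₂ refl)) = reverse-geodesic (geodesic-from vC pC-neighbour rp)
  Model-geodesic (_ , inj₂ (inj₁ refl)) (_ , inj₂ (inj₁ refl)) = subst (Walk Model vA vA) (sym (cheb-self pA)) here
  Model-geodesic (_ , inj₂ (inj₂ refl)) (_ , inj₂ (inj₂ refl)) = subst (Walk Model vC vC) (sym (cheb-self pC)) here
  Model-geodesic (_ , inj₂ (inj₁ refl)) (_ , inj₂ (inj₂ refl)) = pA-pC-geodesic
  Model-geodesic (_ , inj₂ (inj₂ refl)) (_ , inj₂ (inj₁ refl)) = reverse-geodesic pA-pC-geodesic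

  Model-Dist : ∀ a b → Dist Model a b (chebᴹ a b)
  Model-Dist a b = Model-geodesic a b , λ _ → Model-walk-≥-cheb

  Rect-Aligned : ∀ {p q} → Rect p → Rect q → Aligned pA p q ⊎ Aligned pB p q
  Rect-Aligned {x , y} {x₁ , y₁} rp rq with ≤-total ∣ y - y₁ ∣ ∣ x - x₁ ∣
  ... | inj₁ y≤x = inj₁ (Aligned-by-coordinate {pA} {x , y} {x₁ , y₁} (cheb-pA rp) (cheb-pA rq) (m≥n⇒m⊔n≡m y≤x))
  ... | inj₂ x≤y = inj₂ (Aligned-by-coordinate {pB} {x , y} {x₁ , y₁} (cheb-pB rp) (cheb-pB rq) (m≤n⇒m⊔n≡n x≤y))

⊖≡- : ∀ a b → a ⊖ b ≡ + a ℤ.- + b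
⊖≡- a b = sym (ℤ.[+m]-[+n]≡m⊖n a b)

⊖-cong : ∀ a b c d → a + d ≡ c + b → a ⊖ b ≡ c ⊖ d
⊖-cong a b c d eq = begin
  a ⊖ b             ≡⟨ ℤ.+-cancelˡ-⊖ d a b ⟨
  (d + a) ⊖ (d + b) ≡⟨ cong₂ _⊖_ (trans (+-comm d a) eq) (+-comm d b) ⟩
  (c + b) ⊖ (b + d) ≡⟨ cong (_⊖ (b + d)) (+-comm c b) ⟩
  (b + c) ⊖ (b + d) ≡⟨ ℤ.+-cancelˡ-⊖ b c d ⟩
  c ⊖ d             ∎
  where open ≡-Reasoning

⊖-+-⊖ : ∀ a b c d → (a ⊖ b) ℤ.+ (c ⊖ d) ≡ (a + c) ⊖ (b + d)
⊖-+-⊖ a b c d = begin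
  (a ⊖ b) ℤ.+ (c ⊖ d)                  ≡⟨ cong₂ ℤ._+_ (⊖≡- a b) (⊖≡- c d) ⟩
  (+ a ℤ.- + b) ℤ.+ (+ c ℤ.- + d)      ≡⟨ regroup (+ a) (+ b) (+ c) (+ d) ⟩
  (+ a ℤ.+ + c) ℤ.- (+ b ℤ.+ + d)      ≡⟨ cong₂ ℤ._-_ (ℤ.pos-+ a c) (ℤ.pos-+ b d) ⟨
  + (a + c) ℤ.- + (b + d)              ≡⟨ ⊖≡- (a + c) (b + d) ⟨
  (a + c) ⊖ (b + d)                    ∎
  where
  open ≡-Reasoning
  regroup : ∀ A B C D → (A ℤ.- B) ℤ.+ (C ℤ.- D) ≡ (A ℤ.+ C) ℤ.- (B ℤ.+ D)
  regroup = solve-∀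

⊖-⊖ : ∀ a b c d → (a ⊖ b) ℤ.- (c ⊖ d) ≡ (a + d) ⊖ (b + c)
⊖-⊖ a b c d = begin
  (a ⊖ b) ℤ.- (c ⊖ d)                  ≡⟨ cong₂ ℤ._-_ (⊖≡- a b) (⊖≡- c d) ⟩
  (+ a ℤ.- + b) ℤ.- (+ c ℤ.- + d)      ≡⟨ regroup (+ a) (+ b) (+ c) (+ d) ⟩
  (+ a ℤ.+ + d) ℤ.- (+ b ℤ.+ + c)      ≡⟨ cong₂ ℤ._-_ (ℤ.pos-+ a d) (ℤ.pos-+ b c) ⟨
  + (a + d) ℤ.- + (b + c)              ≡⟨ ⊖≡- (a + d) (b + c) ⟨
  (a + d) ⊖ (b + c)                    ∎
  where
  open ≡-Reasoning
  regroup : ∀ A B C D → (A ℤ.- B) ℤ.- (C ℤ.- D) ≡ (A ℤ.+ D) ℤ.- (B ℤ.+ C)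
  regroup = solve-∀

⊖≤⊖⇔ : ∀ a b c d → a ⊖ b ℤ.≤ c ⊖ d ⇔ a + d ≤ c + b
⊖≤⊖⇔ a b c d = mk⇔ ⇒ ⇐
  where
  left : a ⊖ b ≡ (a + d) ⊖ (b + d)
  left = ⊖-cong a b (a + d) (b + d) (trans (cong (_+_ a) (+-comm b d)) (sym (+-assoc a d b)))
  right : c ⊖ d ≡ (c + b) ⊖ (b + d)
  right = ⊖-cong c d (c + b) (b + d) (sym (+-assoc c b d))
  ⇐ : a + d ≤ c + b → a ⊖ b ℤ.≤ c ⊖ d
  ⇐ le = subst₂ ℤ._≤_ (sym left) (sym right) (ℤ.⊖-monoˡ-≤ (b + d) le)
  ⇒ : a ⊖ b ℤ.≤ c ⊖ d → a + d ≤ c + b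
  ⇒ le with a + d ≤? c + b
  ... | yes ok = ok
  ... | no ¬ok = ⊥-elim (ℤ.<⇒≱ (subst₂ ℤ._<_ (sym right) (sym left) (ℤ.⊖-monoˡ-< (b + d) (≰⇒> ¬ok))) le)

∣⊖∣≡∣-∣ : ∀ a b → ℤ.∣ a ⊖ b ∣ ≡ ∣ a - b ∣
∣⊖∣≡∣-∣ a b with ≤-total a b
... | inj₁ a≤b = trans (ℤ.∣⊖∣-≤ a≤b) (sym (m≤n⇒∣m-n∣≡n∸m a≤b))
... | inj₂ b≤a = trans (ℤ.∣m⊖n∣≡∣n⊖m∣ a b) (trans (ℤ.∣⊖∣-≤ b≤a) (sym (m≤n⇒∣n-m∣≡n∸m b≤a)))

∣[a⊖c]-[b⊖c]∣ : ∀ a b c → ℤ.∣ (a ⊖ c) ℤ.- (b ⊖ c) ∣ ≡ ∣ a - b ∣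
∣[a⊖c]-[b⊖c]∣ a b c = trans (cong ℤ.∣_∣ (trans (⊖-⊖ a c b c) (⊖-cong (a + c) (c + b) a b (+-assoc a c b)))) (∣⊖∣≡∣-∣ a b)

⊖-injectiveˡ : ∀ {a b c} → a ⊖ c ≡ b ⊖ c → a ≡ b
⊖-injectiveˡ {a} {b} {c} eq = ≤-antisym (+-cancelʳ-≤ c a b (Equivalence.to (⊖≤⊖⇔ a c b c) (ℤ.≤-reflexive eq)))
                                        (+-cancelʳ-≤ c b a (Equivalence.to (⊖≤⊖⇔ b c a c) (ℤ.≤-reflexive (sym eq))))

⊖-form : ∀ i → Σ ℕ λ a → Σ ℕ λ b → a ⊖ b ≡ i
⊖-form (+ n) = n , 0 , refl
⊖-form -[1+ n ] = 0 , suc n , refl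

module Grid (k : ℕ) where
  open Model k

  Rectᶻ : ℤ × ℤ → Set
  Rectᶻ u = (+ 0 ℤ.≤ s u) × (s u ℤ.≤ + (2 * k + 1)) × (-[1+ 0 ] ℤ.≤ t u) × (t u ℤ.≤ + (2 * k))

  -- Rectᶻ (a ⊖ b , c ⊖ d) with s and t expanded and the subtractions cleared.
  RectLin : ℕ → ℕ → ℕ → ℕ → Set
  RectLin a b c d = (0 + (b + d) ≤ (a + c) + 0) × ((a + c) + 0 ≤ (2 * k + 1) + (b + d))
                  × (0 + (b + c) ≤ (a + d) + 1) × ((a + d) + 0 ≤ 2 * k + (b + c))

  Rectᶻ⇔RectLin : ∀ a b c d → Rectᶻ (a ⊖ b , c ⊖ d) ⇔ RectLin a b c d
  Rectᶻ⇔RectLin a b c d =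
        ⇔-trans (≤-cong refl (⊖-+-⊖ a b c d)) (⊖≤⊖⇔ 0 0 (a + c) (b + d))
    ×-⇔ ⇔-trans (≤-cong (⊖-+-⊖ a b c d) refl) (⊖≤⊖⇔ (a + c) (b + d) (2 * k + 1) 0)
    ×-⇔ ⇔-trans (≤-cong refl (⊖-⊖ a b c d)) (⊖≤⊖⇔ 0 1 (a + d) (b + c))
    ×-⇔ ⇔-trans (≤-cong (⊖-⊖ a b c d) refl) (⊖≤⊖⇔ (a + d) (b + c) (2 * k) 0)
    where
    ≤-cong : ∀ {i j i′ j′} → i ≡ i′ → j ≡ j′ → (i ℤ.≤ j) ⇔ (i′ ℤ.≤ j′)
    ≤-cong refl refl = mk⇔ (λ le → le) (λ le → le)

  RectLin⇔Rect : ∀ x y → RectLin x 1 y k ⇔ Rect (x , y)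
  RectLin⇔Rect x y = mk⇔
    (λ (h₁ , h₂ , h₃ , h₄) → ≤-by-certificate h₁ (solve (x ∷ y ∷ k ∷ [])) , ≤-by-certificate h₂ (solve (x ∷ y ∷ k ∷ []))
                           , ≤-by-certificate h₃ (solve (x ∷ y ∷ k ∷ [])) , ≤-by-certificate h₄ (solve (x ∷ y ∷ k ∷ [])))
    (λ (r₁ , r₂ , r₃ , r₄) → ≤-by-certificate r₁ (solve (x ∷ y ∷ k ∷ [])) , ≤-by-certificate r₂ (solve (x ∷ y ∷ k ∷ []))
                           , ≤-by-certificate r₃ (solve (x ∷ y ∷ k ∷ [])) , ≤-by-certificate r₄ (solve (x ∷ y ∷ k ∷ [])))

  toGrid : Point → ℤ × ℤ
  toGrid (x , y) = x ⊖ 1 , y ⊖ k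

  toGrid-injective : ∀ {p q} → toGrid p ≡ toGrid q → p ≡ q
  toGrid-injective eq = cong₂ _,_ (⊖-injectiveˡ {c = 1} (cong proj₁ eq)) (⊖-injectiveˡ {c = k} (cong proj₂ eq))

  toGrid-King : ∀ p q → King (toGrid p) (toGrid q) ≡ (cheb p q ≡ 1)
  toGrid-King (x , y) (x′ , y′) = cong₂ (λ a b → a ⊔ b ≡ 1) (∣[a⊖c]-[b⊖c]∣ x x′ 1) (∣[a⊖c]-[b⊖c]∣ y y′ k)

  Rectᶻ-toGrid⇔Rect : ∀ p → Rectᶻ (toGrid p) ⇔ Rect p
  Rectᶻ-toGrid⇔Rect (x , y) = ⇔-trans (Rectᶻ⇔RectLin x 1 y k) (RectLin⇔Rect x y)

  toGrid-pA : toGrid pA ≡ (-[1+ 0 ] , + 0)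
  toGrid-pA = cong (-[1+ 0 ] ,_) (ℤ.n⊖n≡0 k)

  toGrid-pC : toGrid pC ≡ (+ (2 * k + 1) , + 1)
  toGrid-pC = cong₂ _,_ (⊖-cong (2 * k + 2) 1 (2 * k + 1) 0 (solve (k ∷ [])))
                        (⊖-cong (suc k) k 1 0 (solve (k ∷ [])))

  toGrid-InModel : ∀ {p} → InModel p → InH k (toGrid p)
  toGrid-InModel {p} (inj₁ r) = inj₁ (Equivalence.from (Rectᶻ-toGrid⇔Rect p) r)
  toGrid-InModel (inj₂ (inj₁ refl)) = inj₂ (inj₁ toGrid-pA)
  toGrid-InModel (inj₂ (inj₂ refl)) = inj₂ (inj₂ toGrid-pC)

  RectLin-bounds : ∀ {a b c d} → RectLin a b c d → b ≤ a + 1 × d ≤ c + k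
  RectLin-bounds {a} {b} {c} {d} (h₁ , _ , h₃ , h₄) = b≤a+1 , d≤c+k
    where
    b≤a+1 : b ≤ a + 1
    b≤a+1 with b ≤? a + 1
    ... | yes b≤ = b≤
    ... | no b≰ = ⊥-elim (1+n≰n {0} (≤-by-certificate (≰⇒> b≰ ⊕ ≰⇒> b≰ ⊕ h₁ ⊕ h₃ ⊕ z≤n {2}) (solve (a ∷ b ∷ c ∷ d ∷ []))))
    d≤c+k : d ≤ c + k
    d≤c+k with d ≤? c + k
    ... | yes d≤ = d≤
    ... | no d≰ = ⊥-elim (1+n≰n {0} (≤-by-certificate (≰⇒> d≰ ⊕ ≰⇒> d≰ ⊕ h₁ ⊕ h₄ ⊕ z≤n {1}) (solve (a ∷ b ∷ c ∷ d ∷ k ∷ []))))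

  Rectᶻ-preimage : ∀ {u} → Rectᶻ u → Σ Point λ p → Rect p × toGrid p ≡ u
  Rectᶻ-preimage {x , y} r with ⊖-form x | ⊖-form y
  ... | a , b , refl | c , d , refl with RectLin-bounds (Equivalence.to (Rectᶻ⇔RectLin a b c d) r)
  ...   | b≤a+1 , d≤c+k = p , Equivalence.to (Rectᶻ-toGrid⇔Rect p) (subst Rectᶻ (sym toGrid-p) r) , toGrid-p
    where
    p : Point
    p = a + 1 ∸ b , c + k ∸ d
    toGrid-p : toGrid p ≡ (a ⊖ b , c ⊖ d)
    toGrid-p = cong₂ _,_ (⊖-cong _ 1 a b (m∸n+n≡m b≤a+1)) (⊖-cong _ k c d (m∸n+n≡m d≤c+k))

  fromGrid : ∀ {u} → InH k u → Σ Point λ p → InModel p × toGrid p ≡ u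
  fromGrid (inj₁ r) with Rectᶻ-preimage r
  ... | p , rp , eq = p , inj₁ rp , eq
  fromGrid (inj₂ (inj₁ refl)) = pA , inj₂ (inj₁ refl) , toGrid-pA
  fromGrid (inj₂ (inj₂ refl)) = pC , inj₂ (inj₂ refl) , toGrid-pC

  Grid-uip : ∀ {u v : ℤ × ℤ} (e e′ : u ≡ v) → e ≡ e′
  Grid-uip = Decidable⇒UIP.≡-irrelevant (≡-dec ℤ._≟_ ℤ._≟_)

  Rectᶻ-irrelevant : ∀ {u} (r r′ : Rectᶻ u) → r ≡ r′
  Rectᶻ-irrelevant (a , b , c , d) (a′ , b′ , c′ , d′) =
    cong₂ _,_ (ℤ.≤-irrelevant a a′) (cong₂ _,_ (ℤ.≤-irrelevant b b′) (cong₂ _,_ (ℤ.≤-irrelevant c c′) (ℤ.≤-irrelevant d d′)))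

  ¬Rectᶻ-A : ¬ Rectᶻ (-[1+ 0 ] , + 0)
  ¬Rectᶻ-A (() , _)

  ¬Rectᶻ-C : ¬ Rectᶻ (+ (2 * k + 1) , + 1)
  ¬Rectᶻ-C (_ , C≤ , _) = 1+n≰n (≤-trans (≤-reflexive (+-comm 1 (2 * k + 1))) (ℤ.drop‿+≤+ C≤))

  InH-irrelevant : ∀ {u} (i j : InH k u) → i ≡ j
  InH-irrelevant {u} (inj₁ r) (inj₁ r′) = cong inj₁ (Rectᶻ-irrelevant {u} r r′)
  InH-irrelevant (inj₁ r) (inj₂ (inj₁ refl)) = ⊥-elim (¬Rectᶻ-A r)
  InH-irrelevant (inj₁ r) (inj₂ (inj₂ refl)) = ⊥-elim (¬Rectᶻ-C r)
  InH-irrelevant (inj₂ (inj₁ refl)) (inj₁ r) = ⊥-elim (¬Rectᶻ-A r)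
  InH-irrelevant (inj₂ (inj₂ refl)) (inj₁ r) = ⊥-elim (¬Rectᶻ-C r)
  InH-irrelevant (inj₂ (inj₁ e)) (inj₂ (inj₁ e′)) = cong (λ e → inj₂ (inj₁ e)) (Grid-uip e e′)
  InH-irrelevant (inj₂ (inj₂ e)) (inj₂ (inj₂ e′)) = cong (λ e → inj₂ (inj₂ e)) (Grid-uip e e′)
  InH-irrelevant (inj₂ (inj₁ refl)) (inj₂ (inj₂ ()))
  InH-irrelevant (inj₂ (inj₂ refl)) (inj₂ (inj₁ ()))

  ≡⇒≡ᴴ : ∀ {a b : V (H2 k)} → proj₁ a ≡ proj₁ b → a ≡ b
  ≡⇒≡ᴴ {u , i} {.u , j} refl = cong (u ,_) (InH-irrelevant i j)

  Model≅H2 : Model ≅ H2 k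
  Model≅H2 = record
    { to      = λ (p , i) → toGrid p , toGrid-InModel i
    ; from    = λ (u , j) → proj₁ (fromGrid j) , proj₁ (proj₂ (fromGrid j))
    ; from-to = λ (p , i) → ≡⇒≡ᴹ (toGrid-injective (proj₂ (proj₂ (fromGrid (toGrid-InModel i)))))
    ; to-from = λ (u , j) → ≡⇒≡ᴴ (proj₂ (proj₂ (fromGrid j)))
    ; to-Adj  = λ (p , _) (q , _) → mk⇔ (subst (λ A → A) (sym (toGrid-King p q))) (subst (λ A → A) (toGrid-King p q))
    }

C4? : ∀ i j → Dec (C4 i j)
C4? i j = T? (c4ℕ (toℕ i) (toℕ j))

Diamond? : ∀ i j → Dec (Diamond i j)
Diamond? i j = T? (diamondℕ (toℕ i) (toℕ j))

-- Checked by exhaustive evaluation, and opaque so that type checking never unfolds the proofs.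
opaque
  C4-irreflexive : ∀ i → ¬ C4 i i
  C4-irreflexive = from-yes (all? λ i → ¬? (C4? i i))

  Diamond-irreflexive : ∀ i → ¬ Diamond i i
  Diamond-irreflexive = from-yes (all? λ i → ¬? (Diamond? i i))

  C4⇒Diamond : ∀ i j → C4 i j → Diamond i j
  C4⇒Diamond = from-yes (all? λ i → all? λ j → C4? i j →-dec Diamond? i j)

  C4-opposite : ∀ a b c d → a ≢ b → a ≢ c → a ≢ d → b ≢ c → b ≢ d → c ≢ d → ¬ C4 a c →
    C4 a b × C4 a d × C4 c b × C4 c d × ¬ C4 b d
  C4-opposite = from-yes (all? λ a → all? λ b → all? λ c → all? λ d →
    ¬? (a ≟ᶠ b) →-dec ¬? (a ≟ᶠ c) →-dec ¬? (a ≟ᶠ d) →-dec ¬? (b ≟ᶠ c) →-dec ¬? (b ≟ᶠ d) →-dec ¬? (c ≟ᶠ d) →-dec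
    ¬? (C4? a c) →-dec (C4? a b ×-dec C4? a d ×-dec C4? c b ×-dec C4? c d ×-dec ¬? (C4? b d)))

C4Diamond : Graph → ℕ → Set
C4Diamond G k = Σ (Fin 4 → V G) (λ w →
    (∀ i j → w i ≡ w j → i ≡ j)
  × (∀ ℓ → k + 1 ≤ ℓ → ℓ ≤ 2 * k → Induces (Pow G ℓ) C4 w)
  × Induces (Pow G (2 * k + 1)) Diamond w)

-- From an isometric copy of the model to four vertices

module Corners (k : ℕ) where
  open Model k

  -- The labels 0, 1, 2, 3 go around B, A, D, C, so that the diamond chord 0–2 is the short diagonal B–D.
  corner : Fin 4 → VM
  corner zero = pB , inj₁ Rect-pB
  corner (suc zero) = vA
  corner (suc (suc zero)) = pD , inj₁ Rect-pD
  corner (suc (suc (suc zero))) = vC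

  cornerDist : Fin 4 → Fin 4 → ℕ
  cornerDist i j with i ≟ᶠ j | c4ℕ (toℕ i) (toℕ j) | diamondℕ (toℕ i) (toℕ j)
  ... | yes _ | _     | _     = 0
  ... | no _  | true  | _     = suc k
  ... | no _  | false | true  = 2 * k + 1
  ... | no _  | false | false = 2 * k + 2

  cheb-pC-middle : ∀ {y} → Rect (suc k , y) → cheb pC (suc k , y) ≡ suc k
  cheb-pC-middle r = +-cancelʳ-≡ (suc k) _ (suc k) (trans (cheb-pC r) 2k+2≡)
    where
    2k+2≡ : 2 * k + 2 ≡ suc k + suc k
    2k+2≡ = solve (k ∷ [])

  cheb-corner : ∀ i j → chebᴹ (corner i) (corner j) ≡ cornerDist i j
  cheb-corner zero zero = cheb-self pB
  cheb-corner zero (suc zero) = trans (cheb-sym pB pA) (cheb-pA Rect-pB)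
  cheb-corner zero (suc (suc zero)) = cheb-pB Rect-pD
  cheb-corner zero (suc (suc (suc zero))) = trans (cheb-sym pB pC) (cheb-pC-middle Rect-pB)
  cheb-corner (suc zero) zero = cheb-pA Rect-pB
  cheb-corner (suc zero) (suc zero) = cheb-self pA
  cheb-corner (suc zero) (suc (suc zero)) = cheb-pA Rect-pD
  cheb-corner (suc zero) (suc (suc (suc zero))) = cheb-pA-pC
  cheb-corner (suc (suc zero)) zero = trans (cheb-sym pD pB) (cheb-pB Rect-pD)
  cheb-corner (suc (suc zero)) (suc zero) = trans (cheb-sym pD pA) (cheb-pA Rect-pD)
  cheb-corner (suc (suc zero)) (suc (suc zero)) = cheb-self pD
  cheb-corner (suc (suc zero)) (suc (suc (suc zero))) = trans (cheb-sym pD pC) (cheb-pC-middle Rect-pD)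
  cheb-corner (suc (suc (suc zero))) zero = cheb-pC-middle Rect-pB
  cheb-corner (suc (suc (suc zero))) (suc zero) = trans (cheb-sym pC pA) cheb-pA-pC
  cheb-corner (suc (suc (suc zero))) (suc (suc zero)) = cheb-pC-middle Rect-pD
  cheb-corner (suc (suc (suc zero))) (suc (suc (suc zero))) = cheb-self pC

  cornerDist≡0⇒≡ : ∀ i j → cornerDist i j ≡ 0 → i ≡ j
  cornerDist≡0⇒≡ i j with i ≟ᶠ j | c4ℕ (toℕ i) (toℕ j) | diamondℕ (toℕ i) (toℕ j)
  ... | yes i≡j | _     | _     = λ _ → i≡j
  ... | no _    | true  | _     = λ ()
  ... | no _    | false | true  = λ eq → ⊥-elim (m+1+n≢0 (2 * k) eq)
  ... | no _    | false | false = λ eq → ⊥-elim (m+1+n≢0 (2 * k) eq)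

  C4⇔cornerDist : ∀ {ℓ} → k + 1 ≤ ℓ → ℓ ≤ 2 * k → ∀ i j → (i ≢ j × cornerDist i j ≤ ℓ) ⇔ C4 i j
  C4⇔cornerDist {ℓ} lo hi i j with i ≟ᶠ j | c4ℕ (toℕ i) (toℕ j) in c4 | diamondℕ (toℕ i) (toℕ j)
  ... | yes refl | _ | _ = mk⇔ (λ (i≢i , _) → ⊥-elim (i≢i refl)) (λ c → ⊥-elim (C4-irreflexive i (subst T (sym c4) c)))
  ... | no i≢j | true | _ = mk⇔ (λ _ → tt) (λ _ → i≢j , subst (_≤ ℓ) (+-comm k 1) lo)
  ... | no _ | false | true = mk⇔ (λ (_ , long≤ℓ) → ⊥-elim (m+1+n≰m (2 * k) (≤-trans long≤ℓ hi)))
                                  (λ ())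
  ... | no _ | false | false = mk⇔ (λ (_ , long≤ℓ) → ⊥-elim (m+1+n≰m (2 * k) (≤-trans long≤ℓ hi)))
                                   (λ ())

  1+k≤2k+1 : suc k ≤ 2 * k + 1
  1+k≤2k+1 = ≤-by-certificate (z≤n {k}) (solve (k ∷ []))

  Diamond⇔cornerDist : ∀ i j → (i ≢ j × cornerDist i j ≤ 2 * k + 1) ⇔ Diamond i j
  Diamond⇔cornerDist i j with i ≟ᶠ j | c4ℕ (toℕ i) (toℕ j) in c4 | diamondℕ (toℕ i) (toℕ j) in dm
  ... | yes refl | _ | _ = mk⇔ (λ (i≢i , _) → ⊥-elim (i≢i refl)) (λ d → ⊥-elim (Diamond-irreflexive i (subst T (sym dm) d)))
  ... | no i≢j | true | _ = mk⇔ (λ _ → subst T dm (C4⇒Diamond i j (subst T (sym c4) tt)))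
                                (λ _ → i≢j , 1+k≤2k+1)
  ... | no i≢j | false | true = mk⇔ (λ _ → tt) (λ _ → i≢j , ≤-refl)
  ... | no _ | false | false = mk⇔ (λ (_ , long≤) → ⊥-elim (1+n≰n {1} (+-cancelˡ-≤ (2 * k) 2 1 long≤))) (λ ())

corners-C4Diamond : ∀ {G} k → IsometricSubgraph (Model.Model k) G → C4Diamond G k
corners-C4Diamond {G} k (f , f-injective , _ , f-Dist) = w , w-injective
  , (λ ℓ lo hi → id , λ i j → ⇔-trans (w-Pow-Adj ℓ i j) (C4⇔cornerDist lo hi i j))
  , (id , λ i j → ⇔-trans (w-Pow-Adj (2 * k + 1) i j) (Diamond⇔cornerDist i j))
  where
  open Model k
  open Corners k
  open Walks G

  w : Fin 4 → V G
  w i = f (corner i)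

  w-Dist : ∀ i j → Dist G (w i) (w j) (cornerDist i j)
  w-Dist i j = subst (Dist G (w i) (w j)) (cheb-corner i j)
                     (Equivalence.to (f-Dist (corner i) (corner j) _) (Model-Dist (corner i) (corner j)))

  w-injective : ∀ i j → w i ≡ w j → i ≡ j
  w-injective i j eq = cornerDist≡0⇒≡ i j (Dist-unique (w-Dist i j) (subst (λ v → Dist G (w i) v 0) eq Dist-refl))

  w-Pow-Adj : ∀ ℓ i j → Adj (Pow G ℓ) (w i) (w j) ⇔ (i ≢ j × cornerDist i j ≤ ℓ)
  w-Pow-Adj ℓ i j = ⇔-trans (Dist⇒Pow-Adj⇔ (w-Dist i j))
    (mk⇔ (λ (w≢ , le) → (λ i≡j → w≢ (cong w i≡j)) , le) (λ (i≢j , le) → (λ eq → i≢j (w-injective i j eq)) , le))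

-- From four vertices to an isometric copy of the model

⟨$⟩ʳ-injective : ∀ {n} (π : Permutation′ n) {x y} → π ⟨$⟩ʳ x ≡ π ⟨$⟩ʳ y → x ≡ y
⟨$⟩ʳ-injective π eq = trans (sym (inverseˡ π)) (trans (cong (π ⟨$⟩ˡ_) eq) (inverseˡ π))

i₀ i₁ i₂ i₃ : Fin 4
i₀ = zero
i₁ = suc zero
i₂ = suc (suc zero)
i₃ = suc (suc (suc zero))

Induces-C4-opposite : ∀ {H w} → Induces H C4 w → (t : Fin 4 → Fin 4) → (∀ x y → t x ≡ t y → x ≡ y) →
  ¬ Adj H (w (t i₁)) (w (t i₃)) →
  Adj H (w (t i₁)) (w (t i₀)) × Adj H (w (t i₁)) (w (t i₂)) × Adj H (w (t i₃)) (w (t i₀)) × Adj H (w (t i₃)) (w (t i₂))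
  × ¬ Adj H (w (t i₀)) (w (t i₂))
Induces-C4-opposite {H} {w} (σ , adj⇔) t t-injective ¬ac =
  adj₁₀ , adj₁₂ , adj₃₀ , adj₃₂ , λ bd → ¬c4₀₂ (Equivalence.to (adj i₀ i₂) bd)
  where
  ρ : Fin 4 → Fin 4
  ρ x = σ ⟨$⟩ˡ t x
  adj : ∀ x y → Adj H (w (t x)) (w (t y)) ⇔ C4 (ρ x) (ρ y)
  adj x y = subst₂ (λ v v′ → Adj H v v′ ⇔ C4 (ρ x) (ρ y)) (cong w (inverseʳ σ)) (cong w (inverseʳ σ)) (adj⇔ (ρ x) (ρ y))
  apart : ∀ x y → x ≢ y → ρ x ≢ ρ y
  apart x y x≢y eq = x≢y (t-injective x y (trans (sym (inverseʳ σ)) (trans (cong (σ ⟨$⟩ʳ_) eq) (inverseʳ σ))))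
  opposite : C4 (ρ i₁) (ρ i₀) × C4 (ρ i₁) (ρ i₂) × C4 (ρ i₃) (ρ i₀) × C4 (ρ i₃) (ρ i₂) × ¬ C4 (ρ i₀) (ρ i₂)
  opposite = C4-opposite (ρ i₁) (ρ i₀) (ρ i₃) (ρ i₂)
    (apart i₁ i₀ λ ()) (apart i₁ i₃ λ ()) (apart i₁ i₂ λ ()) (apart i₀ i₃ λ ()) (apart i₀ i₂ λ ()) (apart i₃ i₂ λ ())
    (λ ac → ¬ac (Equivalence.from (adj i₁ i₃) ac))
  adj₁₀ : Adj H (w (t i₁)) (w (t i₀))
  adj₁₀ = Equivalence.from (adj i₁ i₀) (proj₁ opposite)
  adj₁₂ : Adj H (w (t i₁)) (w (t i₂))
  adj₁₂ = Equivalence.from (adj i₁ i₂) (proj₁ (proj₂ opposite))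
  adj₃₀ : Adj H (w (t i₃)) (w (t i₀))
  adj₃₀ = Equivalence.from (adj i₃ i₀) (proj₁ (proj₂ (proj₂ opposite)))
  adj₃₂ : Adj H (w (t i₃)) (w (t i₂))
  adj₃₂ = Equivalence.from (adj i₃ i₂) (proj₁ (proj₂ (proj₂ (proj₂ opposite))))
  ¬c4₀₂ : ¬ C4 (ρ i₀) (ρ i₂)
  ¬c4₀₂ = proj₂ (proj₂ (proj₂ (proj₂ opposite)))

record ModelCorners (G : Graph) (k : ℕ) : Set where
  field
    wA wB wC wD : V G
    AB : Dist G wA wB (suc k)
    BC : Dist G wB wC (suc k)
    CD : Dist G wC wD (suc k)
    DA : Dist G wD wA (suc k)
    AC : Dist G wA wC (2 * k + 2)
    BD : Dist G wB wD (2 * k + 1)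

level-split : ∀ k → k ≡ 0 ⊎ k + 1 ≤ 2 * k
level-split zero = inj₁ refl
level-split (suc j) = inj₂ (≤-by-certificate (z≤n {j}) (solve (j ∷ [])))

module FromC4Diamond {G : Graph} (symG : Symmetric G) (k : ℕ) (witness : C4Diamond G k) where
  open Walks G

  w : Fin 4 → V G
  w = proj₁ witness

  w-injective : ∀ i j → w i ≡ w j → i ≡ j
  w-injective = proj₁ (proj₂ witness)

  c4s : ∀ ℓ → k + 1 ≤ ℓ → ℓ ≤ 2 * k → Induces (Pow G ℓ) C4 w
  c4s = proj₁ (proj₂ (proj₂ witness))

  π : Permutation′ 4
  π = proj₁ (proj₂ (proj₂ (proj₂ witness)))

  diamond : ∀ i j → Adj (Pow G (2 * k + 1)) (w (π ⟨$⟩ʳ i)) (w (π ⟨$⟩ʳ j)) ⇔ Diamond i j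
  diamond = proj₂ (proj₂ (proj₂ (proj₂ witness)))

  u : Fin 4 → V G
  u x = w (π ⟨$⟩ʳ x)

  u-apart : ∀ x y → x ≢ y → u x ≢ u y
  u-apart x y x≢y eq = x≢y (⟨$⟩ʳ-injective π (w-injective _ _ eq))

  -- Named after the corners of the model they turn out to realise: a c is the non-edge of the
  -- diamond and b d its chord.
  a b c d : V G
  a = u i₁
  b = u i₀
  c = u i₃
  d = u i₂

  a≁c : ∀ {ℓ} → ℓ ≤ 2 * k + 1 → ¬ Adj (Pow G ℓ) a c
  a≁c ℓ≤ adj = Equivalence.to (diamond i₁ i₃) (Pow-mono ℓ≤ adj)

  Square : ℕ → Set
  Square ℓ = Adj (Pow G ℓ) a b × Adj (Pow G ℓ) b c × Adj (Pow G ℓ) c d × Adj (Pow G ℓ) d a × ¬ Adj (Pow G ℓ) b d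

  square : ∀ {ℓ} → ℓ ≤ 2 * k + 1 → Induces (Pow G ℓ) C4 w → Square ℓ
  square {ℓ} ℓ≤ c4 with Induces-C4-opposite {Pow G ℓ} {w} c4 (π ⟨$⟩ʳ_) (λ x y → ⟨$⟩ʳ-injective π) (a≁c ℓ≤)
  ... | ab , ad , cb , cd , ¬bd = ab , Pow-symmetric symG cb , cd , Pow-symmetric symG ad , ¬bd

  Near : V G → V G → Set
  Near x y = InDisk G y (suc k) x

  Sides : Set
  Sides = Near a b × Near b c × Near c d × Near d a

  Gap : Set
  Gap = ∀ m → Dist G b d m → m ≤ 2 * k → ⊥

  -- For k = 0 no level ℓ lies in [k + 1, 2k]; then the diamond itself bounds the sides.
  sides-and-gap : k ≡ 0 ⊎ k + 1 ≤ 2 * k → Sides × Gap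
  sides-and-gap (inj₁ k≡0) = (near i₁ i₀ tt , near i₀ i₃ tt , near i₃ i₂ tt , near i₂ i₁ tt) , gap
    where
    2k+1≤1+k : 2 * k + 1 ≤ suc k
    2k+1≤1+k = subst (λ n → 2 * n + 1 ≤ suc n) (sym k≡0) ≤-refl
    near : ∀ x y → Diamond x y → Near (u x) (u y)
    near x y dm with Equivalence.from (diamond x y) dm
    ... | _ , m , D , m≤ = m , D , ≤-trans m≤ 2k+1≤1+k
    gap : Gap
    gap m D m≤2k = u-apart i₀ i₂ (λ ()) (Dist0⇒≡ (subst (Dist G b d) (n≤0⇒n≡0 (subst (λ n → m ≤ 2 * n) k≡0 m≤2k)) D))
  sides-and-gap (inj₂ k+1≤2k) with square (≤-trans k+1≤2k (m≤m+n (2 * k) 1)) (c4s (k + 1) ≤-refl k+1≤2k)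
  ... | ab , bc , cd , da , _ = (near ab , near bc , near cd , near da) , gap
    where
    near : ∀ {x y} → Adj (Pow G (k + 1)) x y → Near x y
    near (_ , m , D , m≤) = m , D , subst (m ≤_) (+-comm k 1) m≤
    gap : Gap
    gap m D m≤2k = proj₂ (proj₂ (proj₂ (proj₂ (square (m≤m+n (2 * k) 1) (c4s (2 * k) k+1≤2k ≤-refl)))))
                          (u-apart i₀ i₂ (λ ()) , m , D , m≤2k)

  2[k+1]≡ : suc k + suc k ≡ 2 * k + 2
  2[k+1]≡ = solve (k ∷ [])

  across : ∀ {x y} → (∀ m → Dist G x y m → m ≤ 2 * k + 1 → ⊥) → ∀ {n} → Walk G x y n → suc k + suc k ≤ n
  across no-short {n} walk = subst (_≤ n) (trans (sym (+-suc (2 * k) 1)) (sym 2[k+1]≡)) (no-short-Dist⇒walk-> no-short walk)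

  tight-legs : ∀ {x y z} → Near x y → Near y z → (∀ m → Dist G x z m → m ≤ 2 * k + 1 → ⊥) →
    Dist G x y (suc k) × Dist G y z (suc k) × Dist G x z (2 * k + 2)
  tight-legs (_ , D₁ , m₁≤) (_ , D₂ , m₂≤) no-short with tight-path D₁ m₁≤ D₂ m₂≤ (across no-short)
  ... | refl , refl , D = D₁ , D₂ , subst (Dist G _ _) 2[k+1]≡ D

  far : ∀ m → Dist G a c m → m ≤ 2 * k + 1 → ⊥
  far m D m≤ = a≁c ≤-refl (u-apart i₁ i₃ (λ ()) , m , D , m≤)

  BD : Dist G b d (2 * k + 1)
  BD with Equivalence.from (diamond i₀ i₂) tt
  ... | _ , m , D , m≤ = subst (Dist G b d) (≤-antisym m≤ 2k+1≤m) D
    where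
    gap : Gap
    gap = proj₂ (sides-and-gap (level-split k))
    2k+1≤m : 2 * k + 1 ≤ m
    2k+1≤m = subst (_≤ m) (+-comm 1 (2 * k)) (no-short-Dist⇒walk-> gap (proj₁ D))

  modelCorners : ModelCorners G k
  modelCorners with sides-and-gap (level-split k)
  ... | (ab , bc , cd , da) , _ with tight-legs ab bc far | tight-legs cd da (λ m D → far m (Dist-sym symG D))
  ...   | AB , BC , AC | CD , DA , _ = record
    { wA = a ; wB = b ; wC = c ; wD = d ; AB = AB ; BC = BC ; CD = CD ; DA = DA ; AC = AC ; BD = BD }

module Construction {G : Graph} (symG : Symmetric G) (helly : Helly G) (k : ℕ) (corners : ModelCorners G k) where
  open Walks G
  open Model k
  open Corners k
  open ModelCorners corners

  -- A point may be listed with several images; isometry forces them to coincide.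
  record PartialEmbedding : Set where
    field
      pairs     : List (Point × V G)
      isometric : ∀ {p u q v} → (p , u) ∈ pairs → (q , v) ∈ pairs → Dist G u v (cheb p q)
      inModel   : ∀ {p u} → (p , u) ∈ pairs → InModel p
      has-A     : (pA , wA) ∈ pairs
      has-B     : (pB , wB) ∈ pairs
      has-C     : (pC , wC) ∈ pairs
      has-D     : (pD , wD) ∈ pairs
  open PartialEmbedding

  cornerImage : Fin 4 → V G
  cornerImage zero = wB
  cornerImage (suc zero) = wA
  cornerImage (suc (suc zero)) = wD
  cornerImage (suc (suc (suc zero))) = wC

  cornerImage-Dist : ∀ i j → Dist G (cornerImage i) (cornerImage j) (cornerDist i j)
  cornerImage-Dist zero zero = Dist-refl
  cornerImage-Dist zero (suc zero) = Dist-sym symG AB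
  cornerImage-Dist zero (suc (suc zero)) = BD
  cornerImage-Dist zero (suc (suc (suc zero))) = BC
  cornerImage-Dist (suc zero) zero = AB
  cornerImage-Dist (suc zero) (suc zero) = Dist-refl
  cornerImage-Dist (suc zero) (suc (suc zero)) = Dist-sym symG DA
  cornerImage-Dist (suc zero) (suc (suc (suc zero))) = AC
  cornerImage-Dist (suc (suc zero)) zero = Dist-sym symG BD
  cornerImage-Dist (suc (suc zero)) (suc zero) = DA
  cornerImage-Dist (suc (suc zero)) (suc (suc zero)) = Dist-refl
  cornerImage-Dist (suc (suc zero)) (suc (suc (suc zero))) = Dist-sym symG CD
  cornerImage-Dist (suc (suc (suc zero))) zero = Dist-sym symG BC
  cornerImage-Dist (suc (suc (suc zero))) (suc zero) = Dist-sym symG AC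
  cornerImage-Dist (suc (suc (suc zero))) (suc (suc zero)) = CD
  cornerImage-Dist (suc (suc (suc zero))) (suc (suc (suc zero))) = Dist-refl

  cornerPair : Fin 4 → Point × V G
  cornerPair i = proj₁ (corner i) , cornerImage i

  cornerPairs : List (Point × V G)
  cornerPairs = map cornerPair (allFin 4)

  cornerPairs-isometric : ∀ {p u q v} → (p , u) ∈ cornerPairs → (q , v) ∈ cornerPairs → Dist G u v (cheb p q)
  cornerPairs-isometric x∈ y∈ with ∈-map⁻ cornerPair {xs = allFin 4} x∈ | ∈-map⁻ cornerPair {xs = allFin 4} y∈
  ... | i , _ , refl | j , _ , refl = subst (Dist G _ _) (sym (cheb-corner i j)) (cornerImage-Dist i j)

  cornerPairs-inModel : ∀ {p u} → (p , u) ∈ cornerPairs → InModel p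
  cornerPairs-inModel x∈ with ∈-map⁻ cornerPair {xs = allFin 4} x∈
  ... | i , _ , refl = proj₂ (corner i)

  initial : PartialEmbedding
  initial = record
    { pairs = cornerPairs
    ; isometric = cornerPairs-isometric
    ; inModel = cornerPairs-inModel
    ; has-A = ∈-map⁺ cornerPair (∈-allFin (suc zero))
    ; has-B = ∈-map⁺ cornerPair (∈-allFin zero)
    ; has-C = ∈-map⁺ cornerPair (∈-allFin (suc (suc (suc zero))))
    ; has-D = ∈-map⁺ cornerPair (∈-allFin (suc (suc zero)))
    }

  module _ (e : PartialEmbedding) {p : Point} (rp : Rect p) where
    private
      disk : Point × V G → V G × ℕ
      disk (q , u) = u , cheb q p

      pairwise : ∀ {x y} → x ∈ map disk (pairs e) → y ∈ map disk (pairs e) →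
        ∃ λ v → InDisk G (proj₁ x) (proj₂ x) v × InDisk G (proj₁ y) (proj₂ y) v
      pairwise x∈ y∈ with ∈-map⁻ disk {xs = pairs e} x∈ | ∈-map⁻ disk {xs = pairs e} y∈
      ... | (q , _) , x∈′ , refl | (q′ , _) , y∈′ , refl =
        disks-meet symG (isometric e x∈′ y∈′)
          (≤-trans (cheb-triangle q p q′) (+-monoʳ-≤ (cheb q p) (≤-reflexive (cheb-sym p q′))))

      common : ∃ λ v → ∀ {x} → x ∈ map disk (pairs e) → InDisk G (proj₁ x) (proj₂ x) v
      common = helly (map disk (pairs e)) (λ {x} {y} → pairwise {x} {y})

    hellyVertex : V G
    hellyVertex = proj₁ common

    private
      near : ∀ {q u} → (q , u) ∈ pairs e → InDisk G u (cheb q p) hellyVertex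
      near qu∈ = proj₂ common (∈-map⁺ disk qu∈)

      -- Near both ends of a model geodesic through p, the Helly vertex is at the exact distances.
      exact : ∀ {c u c′ u′} → (c , u) ∈ pairs e → (c′ , u′) ∈ pairs e → cheb c c′ ≡ cheb c p + cheb c′ p →
        Dist G hellyVertex u (cheb c p)
      exact {c} {c′ = c′} cu∈ cu′∈ through-p with near cu∈ | near cu′∈
      ... | m , D , m≤ | m′ , D′ , m′≤ = subst (Dist G hellyVertex _) (+-tight m≤ m′≤ sum≤) D
        where
        sum≤ : cheb c p + cheb c′ p ≤ m + m′
        sum≤ = subst (_≤ m + m′) through-p (Dist-triangle (Dist-sym symG D) D′ (isometric e cu∈ cu′∈))

      AC-through-p : cheb pA pC ≡ cheb pA p + cheb pC p
      AC-through-p = trans cheb-pA-pC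
        (sym (trans (cong (_+ cheb pC p) (cheb-pA rp)) (trans (+-comm (proj₁ p) _) (cheb-pC rp))))

      BD-through-p : cheb pB pD ≡ cheb pB p + cheb pD p
      BD-through-p = trans (cheb-pB Rect-pD)
        (sym (trans (cong (_+ cheb pD p) (cheb-pB rp)) (trans (+-comm (proj₂ p) _) (cheb-pD rp))))

      lower-via : ∀ {z w q u m} → (z , w) ∈ pairs e → Dist G hellyVertex w (cheb z p) → (q , u) ∈ pairs e →
        Dist G hellyVertex u m → Aligned z p q → cheb p q ≤ m
      lower-via {z} zw∈ Dz qu∈ Dq (inj₁ z-p-q) =
        +-cancelˡ-≤ (cheb z p) _ _ (subst (_≤ cheb z p + _) z-p-q (Dist-triangle (Dist-sym symG Dz) Dq (isometric e zw∈ qu∈)))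
      lower-via {z} {q = q} zw∈ Dz qu∈ Dq (inj₂ z-q-p) =
        +-cancelˡ-≤ (cheb z q) _ _ (subst (_≤ cheb z q + _) z-q-p
          (Dist-triangle (isometric e zw∈ qu∈) (Dist-sym symG Dq) (Dist-sym symG Dz)))

    hellyVertex-Dist : ∀ {q u} → (q , u) ∈ pairs e → Dist G hellyVertex u (cheb p q)
    hellyVertex-Dist {q} qu∈ with near qu∈
    ... | m , D , m≤ = subst (Dist G hellyVertex _) (≤-antisym (subst (m ≤_) (cheb-sym q p) m≤) (lower (inModel e qu∈))) D
      where
      lower : InModel q → cheb p q ≤ m
      lower (inj₂ (inj₁ refl)) = ≤-reflexive (trans (cheb-sym p pA) (Dist-unique (exact qu∈ (has-C e) AC-through-p) D))
      lower (inj₂ (inj₂ refl)) = ≤-reflexive (trans (cheb-sym p pC) (Dist-unique (exact qu∈ (has-A e)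
                                  (trans (cheb-sym pC pA) (trans AC-through-p (+-comm (cheb pA p) (cheb pC p))))) D))
      lower (inj₁ rq) with Rect-Aligned rp rq
      ... | inj₁ aligned = lower-via (has-A e) (exact (has-A e) (has-C e) AC-through-p) qu∈ D aligned
      ... | inj₂ aligned = lower-via (has-B e) (exact (has-B e) (has-D e) BD-through-p) qu∈ D aligned

  extend : PartialEmbedding → ∀ {p} → Rect p → PartialEmbedding
  extend e {p} rp = record
    { pairs = (p , v) ∷ pairs e
    ; isometric = isometric′
    ; inModel = λ { (here refl) → inj₁ rp ; (there x∈) → inModel e x∈ }
    ; has-A = there (has-A e)
    ; has-B = there (has-B e)
    ; has-C = there (has-C e)
    ; has-D = there (has-D e)
    }
    where
    v : V G
    v = hellyVertex e rp
    isometric′ : ∀ {q u q′ u′} → (q , u) ∈ (p , v) ∷ pairs e → (q′ , u′) ∈ (p , v) ∷ pairs e → Dist G u u′ (cheb q q′)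
    isometric′ (here refl) (here refl) = subst (Dist G v v) (sym (cheb-self p)) Dist-refl
    isometric′ (here refl) (there y∈) = hellyVertex-Dist e rp y∈
    isometric′ {q} (there x∈) (here refl) = subst (Dist G _ v) (cheb-sym p q) (Dist-sym symG (hellyVertex-Dist e rp x∈))
    isometric′ (there x∈) (there y∈) = isometric e x∈ y∈

  extendAll : List Point → PartialEmbedding → PartialEmbedding
  extendAll [] e = e
  extendAll (p ∷ ps) e with Rect? p
  ... | yes rp = extendAll ps (extend e rp)
  ... | no _ = extendAll ps e

  Covered : PartialEmbedding → Point → Set
  Covered e p = ∃ λ u → (p , u) ∈ pairs e

  extendAll-keeps : ∀ ps e {x} → x ∈ pairs e → x ∈ pairs (extendAll ps e)
  extendAll-keeps [] e x∈ = x∈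
  extendAll-keeps (p ∷ ps) e x∈ with Rect? p
  ... | yes rp = extendAll-keeps ps (extend e rp) (there x∈)
  ... | no _ = extendAll-keeps ps e x∈

  extendAll-covers : ∀ ps e {p} → Rect p → p ∈ ps → Covered (extendAll ps e) p
  extendAll-covers (p ∷ ps) e rp (here refl) with Rect? p
  ... | yes rp′ = _ , extendAll-keeps ps (extend e rp′) (here refl)
  ... | no ¬rp = ⊥-elim (¬rp rp)
  extendAll-covers (p′ ∷ ps) e rp (there p∈) with Rect? p′
  ... | yes rp′ = extendAll-covers ps (extend e rp′) rp p∈
  ... | no _ = extendAll-covers ps e rp p∈

  grid : List Point
  grid = cartesianProduct (upTo (2 * k + 2)) (upTo (2 * k + 2))

  Rect⇒∈grid : ∀ {p} → Rect p → p ∈ grid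
  Rect⇒∈grid r = ∈-cartesianProduct⁺ (∈-upTo⁺ (below (Rect⇒x≤2k+1 r))) (∈-upTo⁺ (below (Rect⇒y≤2k+1 r)))
    where
    below : ∀ {n} → n ≤ 2 * k + 1 → n < 2 * k + 2
    below n≤ = ≤-trans (s≤s n≤) (≤-reflexive (sym (+-suc (2 * k) 1)))

  complete : PartialEmbedding
  complete = extendAll grid initial

  complete-covers : ∀ (a : VM) → Covered complete (proj₁ a)
  complete-covers (_ , inj₁ rp) = extendAll-covers grid initial rp (Rect⇒∈grid rp)
  complete-covers (_ , inj₂ (inj₁ refl)) = wA , extendAll-keeps grid initial (has-A initial)
  complete-covers (_ , inj₂ (inj₂ refl)) = wC , extendAll-keeps grid initial (has-C initial)

  embedding : Irreflexive G → IsometricSubgraph Model G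
  embedding irrG = realises-Dist⇒IsometricSubgraph (λ {a} → Model-irreflexive {a}) irrG
    (λ a → proj₁ (complete-covers a)) chebᴹ Model-Dist
    (λ a b → isometric complete (proj₂ (complete-covers a)) (proj₂ (complete-covers b)))

lemma11 : (G : Graph) → Finite G → SimpleGraph G → Connected G → Helly G → (k : ℕ) →
    IsometricSubgraph (H2 k) G
    ⇔ Σ (Fin 4 → V G) (λ w →
        (∀ i j → w i ≡ w j → i ≡ j)
        × (∀ ℓ → k + 1 ≤ ℓ → ℓ ≤ 2 * k → Induces (Pow G ℓ) C4 w)
        × Induces (Pow G (2 * k + 1)) Diamond w)
lemma11 G _ (symG , irrG) _ helly k = ⇔-trans (IsometricSubgraph-≅ (≅-sym (Grid.Model≅H2 k)))
  (mk⇔ (corners-C4Diamond k)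
       (λ witness → Construction.embedding symG helly k (FromC4Diamond.modelCorners symG k witness) irrG))
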